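{- Let $\mathcal{H}$ be a $4$-uniform hypergraph on $2n$ vertices with $\delta_3(\mathcal{H})\geq n-1$, and let $V(\mathcal{H})=A\cup B$ be a partition with $|A|=|B|=n$ such that $|\mathcal{H}(A,A,B,B)|=b(\mathcal{H})$. For every $\epsilon>0$ and sufficiently large $n$: if there is an $\epsilon$-anarchist in $B$, then every vertex in $A$ is $3\epsilon$-typical; and if there is an $\epsilon$-anarchist in $A$, then every vertex in $B$ is $3\epsilon$-typical.
   Context: $\delta_3(\mathcal{H})$ is the minimum over $3$-sets $T$ of vertices of the number of $x$ with $T\cup\{x\}\in E(\mathcal{H})$. $\mathcal{H}(A,A,B,B)=\{e\in E(\mathcal{H}):|e\cap A|=2\}$ and $b(\mathcal{H})$ is the minimum of $|\mathcal{H}(A,A,B,B)|$ over all partitions with $|A|=|B|=n$. For a vertex $v$, $L_v=\{\{u,w,t\}:\{u,w,t,v\}\in E(\mathcal{H})\}$; $l_v^{AAB}$ (resp. $l_v^{ABB}$) is the number of triples in $L_v$ having exactly two (resp. exactly one) vertices in $A$ and the rest in $B$. A vertex $a\in A$ is $\epsilon$-typical if $l_a^{ABB}\leq\epsilon|A|\binom{|B|}{2}$, and an $\epsilon$-anarchist if $l_a^{AAB}\leq\epsilon\binom{|A|}{2}|B|$. A vertex $b\in B$ is $\epsilon$-typical if $l_b^{AAB}\leq\epsilon\binom{|A|}{2}|B|$, and an $\epsilon$-anarchist if $l_b^{ABB}\leq\epsilon|A|\binom{|B|}{2}$.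
   Formalization: The parameter ε ranges over the positive rationals. -}

module Defs where

open import Data.Nat using (ℕ; zero; suc; _+_; _*_; _∸_; _≤_; _≡ᵇ_)
open import Data.Nat.Combinatorics using (_C_)
open import Data.Bool using (Bool; true; false; _∧_; not; T)
open import Data.List using (List; []; _∷_; map; _++_)
open import Data.Vec using (_∷_; [])
open import Data.Fin using (Fin)
open import Data.Fin.Subset using (Subset; ⁅_⁆; ∁; _∩_; _∪_; ∣_∣; _∈_; _∉_)
open import Data.Fin.Subset.Properties using (_∈?_)
open import Data.Integer using (+_)
open import Data.Rational using (ℚ) renaming (_/_ to _÷_; _≤_ to _≤ℚ_; _*_ to _*ℚ_)
open import Relation.Nullary.Decidable using (⌊_⌋)
open import Relation.Binary.PropositionalEquality using (_≡_)

toQ : ℕ → ℚ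
toQ k = (+ k) ÷ 1

allSubsets : (m : ℕ) → List (Subset m)
allSubsets zero    = [] ∷ []
allSubsets (suc m) = map (true ∷_) (allSubsets m) ++ map (false ∷_) (allSubsets m)

countB : {X : Set} → (X → Bool) → List X → ℕ
countB p []       = 0
countB p (x ∷ xs) with p x
... | true  = suc (countB p xs)
... | false = countB p xs

countSets : {m : ℕ} → (Subset m → Bool) → ℕ
countSets {m} p = countB p (allSubsets m)

Hypergraph : ℕ → Set
Hypergraph m = Subset m → Bool

Uniform4 : {m : ℕ} → Hypergraph m → Set
Uniform4 {m} H = (e : Subset m) → T (H e) → ∣ e ∣ ≡ 4

codeg3 : {m : ℕ} → Hypergraph m → Subset m → ℕ
codeg3 {m} H S = countB (λ x → not ⌊ x ∈? S ⌋ ∧ H (S ∪ ⁅ x ⁆)) (Data.List.allFin m)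
  where import Data.List

MinCodeg3≥ : {m : ℕ} → Hypergraph m → ℕ → Set
MinCodeg3≥ {m} H d = (S : Subset m) → ∣ S ∣ ≡ 3 → d ≤ codeg3 H S

-- |H(A,A,B,B)| with B = ∁ A : edges meeting A in exactly 2 vertices
crossAABB : {m : ℕ} → Hypergraph m → Subset m → ℕ
crossAABB H A = countSets (λ e → H e ∧ (∣ e ∩ A ∣ ≡ᵇ 2))

-- |H(A,A,B,B)| = b(H): A attains the minimum over all balanced partitions
IsMinPartition : {m : ℕ} → Hypergraph m → ℕ → Subset m → Set
IsMinPartition {m} H n A =
  ∣ A ∣ ≡ n × ∣ ∁ A ∣ ≡ n × ((A' : Subset m) → ∣ A' ∣ ≡ n → ∣ ∁ A' ∣ ≡ n → crossAABB H A ≤ crossAABB H A')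
  where open import Data.Product using (_×_)

-- triples S ∈ L_v (3-sets, v ∉ S, S ∪ {v} ∈ E(H)) with exactly k vertices in A
-- (and hence 3 - k in B = ∁ A)
linkCount : {m : ℕ} → Hypergraph m → Subset m → Fin m → ℕ → ℕ
linkCount H A v k =
  countSets (λ S → (∣ S ∣ ≡ᵇ 3) ∧ not ⌊ v ∈? S ⌋ ∧ H (S ∪ ⁅ v ⁆) ∧ (∣ S ∩ A ∣ ≡ᵇ k))

lAAB : {m : ℕ} → Hypergraph m → Subset m → Fin m → ℕ
lAAB H A v = linkCount H A v 2

lABB : {m : ℕ} → Hypergraph m → Subset m → Fin m → ℕ
lABB H A v = linkCount H A v 1

thrABB : {m : ℕ} → ℚ → Subset m → ℚ
thrABB ε A = ε *ℚ toQ (∣ A ∣ * (∣ ∁ A ∣ C 2))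

thrAAB : {m : ℕ} → ℚ → Subset m → ℚ
thrAAB ε A = ε *ℚ toQ ((∣ A ∣ C 2) * ∣ ∁ A ∣)

-- for a ∈ A
TypicalA : {m : ℕ} → Hypergraph m → Subset m → ℚ → Fin m → Set
TypicalA H A ε a = toQ (lABB H A a) ≤ℚ thrABB ε A

AnarchistA : {m : ℕ} → Hypergraph m → Subset m → ℚ → Fin m → Set
AnarchistA H A ε a = toQ (lAAB H A a) ≤ℚ thrAAB ε A

-- for b ∈ B = ∁ A
TypicalB : {m : ℕ} → Hypergraph m → Subset m → ℚ → Fin m → Set
TypicalB H A ε b = toQ (lAAB H A b) ≤ℚ thrAAB ε A

AnarchistB : {m : ℕ} → Hypergraph m → Subset m → ℚ → Fin m → Set
AnarchistB H A ε b = toQ (lABB H A b) ≤ℚ thrABB ε A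

-- Let a ∈ A and b ∈ B, and write d_v(j) for the number of edges through v with exactly j vertices in A,
-- so that l_a^{ABB} = d_a(2) and l_b^{ABB} = d_b(1). Moving a to B and b to A gives another balanced
-- partition, and comparing crossing edges with the minimal one yields
--   d_a(2) + d_b(2) ≤ d_a(3) + d_b(1) + O(n²),
-- the error term counting the edges through both a and b. Double counting the triples {b, x, y} with
-- x ∈ A, y ∈ B - b against δ₃ ≥ n - 1 gives 2 (d_b(1) + d_b(2)) ≥ n (n - 1)², while trivially
-- 2 d_a(3) ≤ n (n - 1)². Hence d_a(2) ≤ 2 d_b(1) + O(n²): if b is an ε-anarchist then a is 3ε-typical
-- for large n. The second claim is the first one for the partition (B, A).

module Submission where

open import Defs
open import Data.Bool using (Bool; true; false; _∧_; _∨_; not; T)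
open import Data.Bool.Properties using (∧-zeroʳ; ∧-identityʳ; ∨-conicalˡ; not-involutive)
open import Data.Fin using (Fin; zero; suc)
open import Data.Fin.Properties using (_≟_)
open import Data.Fin.Subset using (Subset; ⁅_⁆; ∁; _∩_; _∪_; _─_; _-_; ∣_∣; _∈_; _∉_; ⊥; ⊤)
open import Data.Fin.Subset.Properties
  using ( _∈?_; x∈∁p⇒x∉p; p─q⊆p; p─⊥≡p; ∣∁p∣≡n∸∣p∣; ∣⊥∣≡0; ∣⁅x⁆∣≡1
        ; ∩-comm; ∩-identityˡ; ∩-identityʳ; ∩-zeroˡ; ∪-identityʳ)
import Data.Integer as ℤ
import Data.Integer.Properties as ℤ
open import Data.List using ([]; _∷_; _++_; map; tabulate)
open import Data.Nat hiding (_≟_; ∣_-_∣)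
open import Data.Nat.Combinatorics using (_C_; nC1≡n; nCk+nC[k+1]≡[n+1]C[k+1])
open import Data.Nat.Coprimality using (Coprime)
open import Data.Nat.Properties hiding (_≟_)
open import Data.Nat.Solver using (module +-*-Solver)
open import Data.Product using (_×_; _,_; ∃-syntax)
open import Data.Rational as ℚ using (ℚ; mkℚ; toℚᵘ)
open import Data.Rational.Properties using (toℚᵘ-fromℚᵘ; toℚᵘ-homo-*; toℚᵘ-mono-≤; toℚᵘ-cancel-≤)
open import Data.Rational.Unnormalised using (mkℚᵘ; *≡*; *≤*)
  renaming (_*_ to _*ᵘ_; _≃_ to _≃ᵘ_; _≤_ to _≤ᵘ_)
import Data.Rational.Unnormalised.Properties as ℚᵘ
open import Data.Vec using (_∷_; []; lookup; here; there)
open import Data.Vec.Properties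
  using (lookup-zipWith; lookup-replicate; []=⇒lookup; lookup⇒[]=; map-∘; map-cong; map-id)
open import Function using (_∘_)
open import Function.Bundles using (_⇔_; mk⇔; Equivalence)
open import Relation.Binary.PropositionalEquality
open import Relation.Nullary using (yes; no; does; contradiction)
open import Relation.Nullary.Decidable using (⌊_⌋; dec-false)

open import Algebra.Properties.CommutativeSemigroup +-commutativeSemigroup
  using (xy∙z≈zx∙y) renaming (interchange to +-interchange)
open import Algebra.Properties.Semiring.Sum +-*-semiring
  using (sum; sum-cong-≗; ∑-distrib-+; *-distribˡ-sum; *-distribʳ-sum)
open +-*-Solver using (solve; _:+_; _:*_; _:^_; con; _:=_)

𝟙 : Bool → ℕ
𝟙 true  = 1
𝟙 false = 0

𝟙-∧ : ∀ a b → 𝟙 (a ∧ b) ≡ 𝟙 a * 𝟙 b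
𝟙-∧ true  b = sym (+-identityʳ (𝟙 b))
𝟙-∧ false b = refl

≡ᵇ≡true⇒≡ : ∀ {x y} → (x ≡ᵇ y) ≡ true → x ≡ y
≡ᵇ≡true⇒≡ {x} {y} eq = ≡ᵇ⇒≡ x y (subst T (sym eq) _)

𝟙-≡ᵇ-≢ : ∀ {x y} → x ≢ y → 𝟙 (x ≡ᵇ y) ≡ 0
𝟙-≡ᵇ-≢ {x} {y} x≢y with x ≡ᵇ y in eq
... | true  = contradiction (≡ᵇ≡true⇒≡ eq) x≢y
... | false = refl

sum-mono-≤ : ∀ {n} {f g : Fin n → ℕ} → (∀ i → f i ≤ g i) → sum f ≤ sum g
sum-mono-≤ {zero}  f≤g = z≤n
sum-mono-≤ {suc n} f≤g = +-mono-≤ (f≤g zero) (sum-mono-≤ (f≤g ∘ suc))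

∑ₛ : ∀ {m} → (Subset m → ℕ) → ℕ
∑ₛ {zero}  f = f []
∑ₛ {suc m} f = ∑ₛ (f ∘ (true ∷_)) + ∑ₛ (f ∘ (false ∷_))

∑ₛ-cong : ∀ {m} {f g : Subset m → ℕ} → (∀ S → f S ≡ g S) → ∑ₛ f ≡ ∑ₛ g
∑ₛ-cong {zero}  f≗g = f≗g []
∑ₛ-cong {suc m} f≗g = cong₂ _+_ (∑ₛ-cong (f≗g ∘ (true ∷_))) (∑ₛ-cong (f≗g ∘ (false ∷_)))

∑ₛ-mono-≤ : ∀ {m} {f g : Subset m → ℕ} → (∀ S → f S ≤ g S) → ∑ₛ f ≤ ∑ₛ g
∑ₛ-mono-≤ {zero}  f≤g = f≤g []
∑ₛ-mono-≤ {suc m} f≤g = +-mono-≤ (∑ₛ-mono-≤ (f≤g ∘ (true ∷_))) (∑ₛ-mono-≤ (f≤g ∘ (false ∷_)))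

∑ₛ-zero : ∀ {m} → ∑ₛ {m} (λ _ → 0) ≡ 0
∑ₛ-zero {zero}  = refl
∑ₛ-zero {suc m} = cong₂ _+_ (∑ₛ-zero {m}) (∑ₛ-zero {m})

∑ₛ-distrib-+ : ∀ {m} (f g : Subset m → ℕ) → ∑ₛ (λ S → f S + g S) ≡ ∑ₛ f + ∑ₛ g
∑ₛ-distrib-+ {zero}  f g = refl
∑ₛ-distrib-+ {suc m} f g = begin
  ∑ₛ (λ S → f (true ∷ S) + g (true ∷ S)) + ∑ₛ (λ S → f (false ∷ S) + g (false ∷ S))
    ≡⟨ cong₂ _+_ (∑ₛ-distrib-+ (f ∘ (true ∷_)) (g ∘ (true ∷_))) (∑ₛ-distrib-+ (f ∘ (false ∷_)) (g ∘ (false ∷_))) ⟩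
  (∑ₛ (f ∘ (true ∷_)) + ∑ₛ (g ∘ (true ∷_))) + (∑ₛ (f ∘ (false ∷_)) + ∑ₛ (g ∘ (false ∷_)))
    ≡⟨ +-interchange (∑ₛ (f ∘ (true ∷_))) (∑ₛ (g ∘ (true ∷_))) (∑ₛ (f ∘ (false ∷_))) (∑ₛ (g ∘ (false ∷_))) ⟩
  ∑ₛ f + ∑ₛ g ∎
  where open ≡-Reasoning

*-distribˡ-∑ₛ : ∀ {m} c (f : Subset m → ℕ) → c * ∑ₛ f ≡ ∑ₛ (λ S → c * f S)
*-distribˡ-∑ₛ {zero}  c f = refl
*-distribˡ-∑ₛ {suc m} c f = trans (*-distribˡ-+ c (∑ₛ (f ∘ (true ∷_))) _)
  (cong₂ _+_ (*-distribˡ-∑ₛ c (f ∘ (true ∷_))) (*-distribˡ-∑ₛ c (f ∘ (false ∷_))))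

∑ₛ-∑-comm : ∀ {m k} (f : Subset m → Fin k → ℕ) → ∑ₛ (λ S → sum (f S)) ≡ sum (λ x → ∑ₛ (λ S → f S x))
∑ₛ-∑-comm {zero}  f = refl
∑ₛ-∑-comm {suc m} f = trans (cong₂ _+_ (∑ₛ-∑-comm (f ∘ (true ∷_))) (∑ₛ-∑-comm (f ∘ (false ∷_))))
  (sym (∑-distrib-+ (λ x → ∑ₛ (λ S → f (true ∷ S) x)) (λ x → ∑ₛ (λ S → f (false ∷ S) x))))

countB-++ : ∀ {X : Set} (p : X → Bool) xs ys → countB p (xs ++ ys) ≡ countB p xs + countB p ys
countB-++ p []       ys = refl
countB-++ p (x ∷ xs) ys with p x
... | true  = cong suc (countB-++ p xs ys)
... | false = countB-++ p xs ys

countB-map : ∀ {X Y : Set} (p : Y → Bool) (f : X → Y) xs → countB p (map f xs) ≡ countB (p ∘ f) xs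
countB-map p f []       = refl
countB-map p f (x ∷ xs) with p (f x)
... | true  = cong suc (countB-map p f xs)
... | false = countB-map p f xs

countB-tabulate : ∀ {X : Set} {n} (p : X → Bool) (f : Fin n → X) → countB p (tabulate f) ≡ sum (𝟙 ∘ p ∘ f)
countB-tabulate {n = zero}  p f = refl
countB-tabulate {n = suc n} p f with p (f zero)
... | true  = cong suc (countB-tabulate p (f ∘ suc))
... | false = countB-tabulate p (f ∘ suc)

countSets≡∑ₛ : ∀ {m} (p : Subset m → Bool) → countSets p ≡ ∑ₛ (𝟙 ∘ p)
countSets≡∑ₛ {zero} p with p []
... | true  = refl
... | false = refl
countSets≡∑ₛ {suc m} p = begin
  countB p (map (true ∷_) (allSubsets m) ++ map (false ∷_) (allSubsets m))
    ≡⟨ countB-++ p (map (true ∷_) (allSubsets m)) _ ⟩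
  countB p (map (true ∷_) (allSubsets m)) + countB p (map (false ∷_) (allSubsets m))
    ≡⟨ cong₂ _+_ (countB-map p (true ∷_) (allSubsets m)) (countB-map p (false ∷_) (allSubsets m)) ⟩
  countSets (p ∘ (true ∷_)) + countSets (p ∘ (false ∷_))
    ≡⟨ cong₂ _+_ (countSets≡∑ₛ (p ∘ (true ∷_))) (countSets≡∑ₛ (p ∘ (false ∷_))) ⟩
  ∑ₛ (𝟙 ∘ p) ∎
  where open ≡-Reasoning

does-∈? : ∀ {m} (x : Fin m) (S : Subset m) → ⌊ x ∈? S ⌋ ≡ lookup S x
does-∈? x S with x ∈? S | lookup S x in eq
... | yes x∈S | _     = trans (sym ([]=⇒lookup x∈S)) eq
... | no  _   | false = refl
... | no  x∉S | true  = contradiction (lookup⇒[]= x S eq) x∉S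

lookup-⁅⁆ : ∀ {m} (x y : Fin m) → lookup ⁅ x ⁆ y ≡ does (x ≟ y)
lookup-⁅⁆ zero    zero    = refl
lookup-⁅⁆ zero    (suc y) = lookup-replicate y false
lookup-⁅⁆ (suc x) zero    = refl
lookup-⁅⁆ (suc x) (suc y) = lookup-⁅⁆ x y

lookup-∪ : ∀ {m} (p q : Subset m) x → lookup (p ∪ q) x ≡ lookup p x ∨ lookup q x
lookup-∪ p q x = lookup-zipWith _∨_ x p q

lookup-⁅⁆-≢ : ∀ {m} {x y : Fin m} → x ≢ y → lookup ⁅ x ⁆ y ≡ false
lookup-⁅⁆-≢ {x = x} {y} x≢y = trans (lookup-⁅⁆ x y) (dec-false (x ≟ y) x≢y)

∣p∣≡∑ : ∀ {m} (p : Subset m) → ∣ p ∣ ≡ sum (𝟙 ∘ lookup p)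
∣p∣≡∑ []          = refl
∣p∣≡∑ (true  ∷ p) = cong suc (∣p∣≡∑ p)
∣p∣≡∑ (false ∷ p) = ∣p∣≡∑ p

∣p∩q∣≡∑ : ∀ {m} (p q : Subset m) → ∣ p ∩ q ∣ ≡ sum (λ x → 𝟙 (lookup p x ∧ lookup q x))
∣p∩q∣≡∑ p q = trans (∣p∣≡∑ (p ∩ q)) (sum-cong-≗ (λ x → cong 𝟙 (lookup-zipWith _∧_ x p q)))

∣[q∪⁅x⁆]∩p∣ : ∀ {m} (q p : Subset m) x → lookup q x ≡ false →
  ∣ (q ∪ ⁅ x ⁆) ∩ p ∣ ≡ ∣ q ∩ p ∣ + 𝟙 (lookup p x)
∣[q∪⁅x⁆]∩p∣ (false ∷ q) (true  ∷ p) zero    _ = trans (cong (λ r → suc ∣ r ∩ p ∣) (∪-identityʳ q)) (+-comm 1 _)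
∣[q∪⁅x⁆]∩p∣ (false ∷ q) (false ∷ p) zero    _ = trans (cong (λ r → ∣ r ∩ p ∣) (∪-identityʳ q)) (sym (+-identityʳ _))
∣[q∪⁅x⁆]∩p∣ (true  ∷ q) (true  ∷ p) (suc x) e = cong suc (∣[q∪⁅x⁆]∩p∣ q p x e)
∣[q∪⁅x⁆]∩p∣ (true  ∷ q) (false ∷ p) (suc x) e = ∣[q∪⁅x⁆]∩p∣ q p x e
∣[q∪⁅x⁆]∩p∣ (false ∷ q) (true  ∷ p) (suc x) e = ∣[q∪⁅x⁆]∩p∣ q p x e
∣[q∪⁅x⁆]∩p∣ (false ∷ q) (false ∷ p) (suc x) e = ∣[q∪⁅x⁆]∩p∣ q p x e

∣⁅x⁆∩p∣ : ∀ {m} (x : Fin m) (p : Subset m) → ∣ ⁅ x ⁆ ∩ p ∣ ≡ 𝟙 (lookup p x)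
∣⁅x⁆∩p∣ {suc m} zero    (true  ∷ p) = cong suc (trans (cong ∣_∣ (∩-zeroˡ p)) (∣⊥∣≡0 m))
∣⁅x⁆∩p∣ {suc m} zero    (false ∷ p) = trans (cong ∣_∣ (∩-zeroˡ p)) (∣⊥∣≡0 m)
∣⁅x⁆∩p∣         (suc x) (_     ∷ p) = ∣⁅x⁆∩p∣ x p

∣q∪⁅x⁆∣ : ∀ {m} (q : Subset m) x → lookup q x ≡ false → ∣ q ∪ ⁅ x ⁆ ∣ ≡ suc ∣ q ∣
∣q∪⁅x⁆∣ q x e = begin
  ∣ q ∪ ⁅ x ⁆ ∣            ≡⟨ cong ∣_∣ (∩-identityʳ (q ∪ ⁅ x ⁆)) ⟨
  ∣ (q ∪ ⁅ x ⁆) ∩ ⊤ ∣      ≡⟨ ∣[q∪⁅x⁆]∩p∣ q ⊤ x e ⟩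
  ∣ q ∩ ⊤ ∣ + 𝟙 (lookup ⊤ x) ≡⟨ cong₂ (λ r b → ∣ r ∣ + 𝟙 b) (∩-identityʳ q) (lookup-replicate x true) ⟩
  ∣ q ∣ + 1                ≡⟨ +-comm ∣ q ∣ 1 ⟩
  suc ∣ q ∣                ∎
  where open ≡-Reasoning

∣p∩q∣+∣p∩∁q∣≡∣p∣ : ∀ {m} (p q : Subset m) → ∣ p ∩ q ∣ + ∣ p ∩ ∁ q ∣ ≡ ∣ p ∣
∣p∩q∣+∣p∩∁q∣≡∣p∣ []          []          = refl
∣p∩q∣+∣p∩∁q∣≡∣p∣ (true  ∷ p) (true  ∷ q) = cong suc (∣p∩q∣+∣p∩∁q∣≡∣p∣ p q)
∣p∩q∣+∣p∩∁q∣≡∣p∣ (true  ∷ p) (false ∷ q) = trans (+-suc _ _) (cong suc (∣p∩q∣+∣p∩∁q∣≡∣p∣ p q))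
∣p∩q∣+∣p∩∁q∣≡∣p∣ (false ∷ p) (_     ∷ q) = ∣p∩q∣+∣p∩∁q∣≡∣p∣ p q

∣p∩[q-x]∣ : ∀ {m} (p : Subset m) {q : Subset m} {x : Fin m} → x ∈ q →
  𝟙 (lookup p x) + ∣ p ∩ (q - x) ∣ ≡ ∣ p ∩ q ∣
∣p∩[q-x]∣ (true  ∷ p) {_ ∷ q} here = cong (λ r → suc ∣ p ∩ r ∣) (p─⊥≡p q)
∣p∩[q-x]∣ (false ∷ p) {_ ∷ q} here = cong (λ r → ∣ p ∩ r ∣) (p─⊥≡p q)
∣p∩[q-x]∣ (true  ∷ p) {true  ∷ q} (there x∈q) = trans (+-suc _ _) (cong suc (∣p∩[q-x]∣ p x∈q))
∣p∩[q-x]∣ (true  ∷ p) {false ∷ q} (there x∈q) = ∣p∩[q-x]∣ p x∈q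
∣p∩[q-x]∣ (false ∷ p) {_     ∷ q} (there x∈q) = ∣p∩[q-x]∣ p x∈q

∣p-x∣ : ∀ {m} {x : Fin m} {p : Subset m} → x ∈ p → suc ∣ p - x ∣ ≡ ∣ p ∣
∣p-x∣ {x = x} {p} x∈p = begin
  suc ∣ p - x ∣                         ≡⟨ cong (λ r → suc ∣ r ∣) (∩-identityˡ (p - x)) ⟨
  suc ∣ ⊤ ∩ (p - x) ∣                   ≡⟨ cong (λ t → 𝟙 t + ∣ ⊤ ∩ (p - x) ∣) (lookup-replicate x true) ⟨
  𝟙 (lookup ⊤ x) + ∣ ⊤ ∩ (p - x) ∣      ≡⟨ ∣p∩[q-x]∣ ⊤ x∈p ⟩
  ∣ ⊤ ∩ p ∣                             ≡⟨ cong ∣_∣ (∩-identityˡ p) ⟩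
  ∣ p ∣                                 ∎
  where open ≡-Reasoning

x∉p-x : ∀ {m} (p : Subset m) (x : Fin m) → x ∉ p - x
x∉p-x (_ ∷ p) zero    ()
x∉p-x (_ ∷ p) (suc x) (there x∈p-x) = x∉p-x p x x∈p-x

y∈p-x⇒x≢y : ∀ {m} {x y : Fin m} (p : Subset m) → y ∈ p - x → x ≢ y
y∈p-x⇒x≢y p y∈p-x refl = x∉p-x p _ y∈p-x

x∈p∧y∈∁p⇒x≢y : ∀ {m} {x y : Fin m} {p : Subset m} → x ∈ p → y ∈ ∁ p → x ≢ y
x∈p∧y∈∁p⇒x≢y x∈p y∈∁p refl = x∈∁p⇒x∉p y∈∁p x∈p

lookup-─ : ∀ {m} (p q : Subset m) x → lookup q x ≡ false → lookup (p ─ q) x ≡ lookup p x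
lookup-─ (_ ∷ p) (false ∷ q) zero    _ = refl
lookup-─ (_ ∷ p) (_     ∷ q) (suc x) e = lookup-─ p q x e

x∈∁p⇒lookup≡false : ∀ {m} {x : Fin m} {p : Subset m} → x ∈ ∁ p → lookup p x ≡ false
x∈∁p⇒lookup≡false {p = false ∷ p} here         = refl
x∈∁p⇒lookup≡false {p = _     ∷ p} (there x∈∁p) = x∈∁p⇒lookup≡false x∈∁p

∁-involutive : ∀ {m} (p : Subset m) → ∁ (∁ p) ≡ p
∁-involutive p = trans (sym (map-∘ not not p)) (trans (map-cong not-involutive p) (map-id p))

∑ₛ-insert : ∀ {m} (v : Fin m) (G : Subset m → ℕ) →
  ∑ₛ (λ S → 𝟙 (not (lookup S v)) * G (S ∪ ⁅ v ⁆)) ≡ ∑ₛ (λ T → 𝟙 (lookup T v) * G T)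
∑ₛ-insert {suc m} zero G = begin
  ∑ₛ {m} (λ _ → 0) + ∑ₛ (λ S → G (true ∷ (S ∪ ⊥)) + 0)
    ≡⟨ cong₂ _+_ (∑ₛ-zero {m}) (∑ₛ-cong (λ S → cong (λ r → G (true ∷ r) + 0) (∪-identityʳ S))) ⟩
  0 + ∑ₛ (λ S → G (true ∷ S) + 0)
    ≡⟨ +-comm 0 _ ⟩
  ∑ₛ (λ S → G (true ∷ S) + 0) + 0
    ≡⟨ cong (∑ₛ (λ S → G (true ∷ S) + 0) +_) (∑ₛ-zero {m}) ⟨
  ∑ₛ (λ S → G (true ∷ S) + 0) + ∑ₛ {m} (λ _ → 0) ∎
  where open ≡-Reasoning
∑ₛ-insert {suc m} (suc v) G = cong₂ _+_ (∑ₛ-insert v (G ∘ (true ∷_))) (∑ₛ-insert v (G ∘ (false ∷_)))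

infix 7 _⊆ᵇ_

_⊆ᵇ_ : ∀ {m} → Subset m → Subset m → Bool
[]      ⊆ᵇ []      = true
(s ∷ p) ⊆ᵇ (t ∷ q) = (not s ∨ t) ∧ (p ⊆ᵇ q)

⊆ᵇ⇒∣p∣≤∣q∣ : ∀ {m} (p q : Subset m) → p ⊆ᵇ q ≡ true → ∣ p ∣ ≤ ∣ q ∣
⊆ᵇ⇒∣p∣≤∣q∣ []          []          _ = z≤n
⊆ᵇ⇒∣p∣≤∣q∣ (true  ∷ p) (true  ∷ q) e = s≤s (⊆ᵇ⇒∣p∣≤∣q∣ p q e)
⊆ᵇ⇒∣p∣≤∣q∣ (false ∷ p) (true  ∷ q) e = m≤n⇒m≤1+n (⊆ᵇ⇒∣p∣≤∣q∣ p q e)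
⊆ᵇ⇒∣p∣≤∣q∣ (false ∷ p) (false ∷ q) e = ⊆ᵇ⇒∣p∣≤∣q∣ p q e

∑ₛ-⊇-same-size : ∀ {m} (S : Subset m) (G : Subset m → ℕ) →
  ∑ₛ (λ T → 𝟙 (S ⊆ᵇ T ∧ (∣ T ∣ ≡ᵇ ∣ S ∣)) * G T) ≡ G S
∑ₛ-⊇-same-size []          G = +-identityʳ (G [])
∑ₛ-⊇-same-size {suc m} (true  ∷ S) G = begin
  ∑ₛ (λ T → 𝟙 (S ⊆ᵇ T ∧ (∣ T ∣ ≡ᵇ ∣ S ∣)) * G (true ∷ T)) + ∑ₛ {m} (λ _ → 0)
    ≡⟨ cong₂ _+_ (∑ₛ-⊇-same-size S (G ∘ (true ∷_))) (∑ₛ-zero {m}) ⟩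
  G (true ∷ S) + 0 ≡⟨ +-identityʳ _ ⟩
  G (true ∷ S) ∎
  where open ≡-Reasoning
∑ₛ-⊇-same-size {suc m} (false ∷ S) G = begin
  ∑ₛ (λ T → 𝟙 (S ⊆ᵇ T ∧ (suc ∣ T ∣ ≡ᵇ ∣ S ∣)) * G (true ∷ T)) + ∑ₛ rest
    ≡⟨ cong (_+ ∑ₛ rest) (trans (∑ₛ-cong too-big) (∑ₛ-zero {m})) ⟩
  0 + ∑ₛ rest
    ≡⟨ ∑ₛ-⊇-same-size S (G ∘ (false ∷_)) ⟩
  G (false ∷ S) ∎
  where
  open ≡-Reasoning
  rest : Subset m → ℕ
  rest T = 𝟙 (S ⊆ᵇ T ∧ (∣ T ∣ ≡ᵇ ∣ S ∣)) * G (false ∷ T)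
  too-big : ∀ T → 𝟙 (S ⊆ᵇ T ∧ (suc ∣ T ∣ ≡ᵇ ∣ S ∣)) * G (true ∷ T) ≡ 0
  too-big T with S ⊆ᵇ T in S⊆T
  ... | false = refl
  ... | true  = cong (_* G (true ∷ T))
                  (𝟙-≡ᵇ-≢ (λ eq → 1+n≰n (subst (_≤ ∣ T ∣) (sym eq) (⊆ᵇ⇒∣p∣≤∣q∣ S T S⊆T))))

∑-extensions : ∀ {m} (S : Subset m) (G : Subset m → ℕ) →
  sum (λ z → 𝟙 (not (lookup S z)) * G (S ∪ ⁅ z ⁆)) ≡ ∑ₛ (λ T → 𝟙 (S ⊆ᵇ T ∧ (∣ T ∣ ≡ᵇ suc ∣ S ∣)) * G T)
∑-extensions []          G = refl
∑-extensions {suc m} (true  ∷ S) G = begin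
  sum (λ z → 𝟙 (not (lookup S z)) * G (true ∷ (S ∪ ⁅ z ⁆)))
    ≡⟨ ∑-extensions S (G ∘ (true ∷_)) ⟩
  ∑ₛ (λ T → 𝟙 (S ⊆ᵇ T ∧ (∣ T ∣ ≡ᵇ suc ∣ S ∣)) * G (true ∷ T))
    ≡⟨ +-identityʳ _ ⟨
  ∑ₛ (λ T → 𝟙 (S ⊆ᵇ T ∧ (∣ T ∣ ≡ᵇ suc ∣ S ∣)) * G (true ∷ T)) + 0
    ≡⟨ cong (∑ₛ (λ T → 𝟙 (S ⊆ᵇ T ∧ (∣ T ∣ ≡ᵇ suc ∣ S ∣)) * G (true ∷ T)) +_) (∑ₛ-zero {m}) ⟨
  _ ∎
  where open ≡-Reasoning
∑-extensions (false ∷ S) G = cong₂ _+_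
  (trans (+-identityʳ _) (trans (cong (λ r → G (true ∷ r)) (∪-identityʳ S)) (sym (∑ₛ-⊇-same-size S (G ∘ (true ∷_))))))
  (∑-extensions S (G ∘ (false ∷_)))

Distinct₃ : ∀ {m} → Fin m → Fin m → Fin m → Set
Distinct₃ v x y = v ≢ x × v ≢ y × x ≢ y

triple : ∀ {m} → Fin m → Fin m → Fin m → Subset m
triple v x y = (⁅ v ⁆ ∪ ⁅ x ⁆) ∪ ⁅ y ⁆

lookup-⁅⁆∪⁅⁆-≢ : ∀ {m} {v x y : Fin m} → v ≢ y → x ≢ y → lookup (⁅ v ⁆ ∪ ⁅ x ⁆) y ≡ false
lookup-⁅⁆∪⁅⁆-≢ {v = v} {x} {y} v≢y x≢y =
  trans (lookup-∪ ⁅ v ⁆ ⁅ x ⁆ y) (cong₂ _∨_ (lookup-⁅⁆-≢ v≢y) (lookup-⁅⁆-≢ x≢y))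

∣triple∩p∣ : ∀ {m} {v x y : Fin m} (p : Subset m) → Distinct₃ v x y →
  ∣ triple v x y ∩ p ∣ ≡ 𝟙 (lookup p v) + 𝟙 (lookup p x) + 𝟙 (lookup p y)
∣triple∩p∣ {v = v} {x} {y} p (v≢x , v≢y , x≢y) = begin
  ∣ ((⁅ v ⁆ ∪ ⁅ x ⁆) ∪ ⁅ y ⁆) ∩ p ∣
    ≡⟨ ∣[q∪⁅x⁆]∩p∣ (⁅ v ⁆ ∪ ⁅ x ⁆) p y (lookup-⁅⁆∪⁅⁆-≢ v≢y x≢y) ⟩
  ∣ (⁅ v ⁆ ∪ ⁅ x ⁆) ∩ p ∣ + 𝟙 (lookup p y)
    ≡⟨ cong (_+ 𝟙 (lookup p y)) (∣[q∪⁅x⁆]∩p∣ ⁅ v ⁆ p x (lookup-⁅⁆-≢ v≢x)) ⟩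
  ∣ ⁅ v ⁆ ∩ p ∣ + 𝟙 (lookup p x) + 𝟙 (lookup p y)
    ≡⟨ cong (λ r → r + 𝟙 (lookup p x) + 𝟙 (lookup p y)) (∣⁅x⁆∩p∣ v p) ⟩
  𝟙 (lookup p v) + 𝟙 (lookup p x) + 𝟙 (lookup p y) ∎
  where open ≡-Reasoning

∣triple∣ : ∀ {m} {v x y : Fin m} → Distinct₃ v x y → ∣ triple v x y ∣ ≡ 3
∣triple∣ {v = v} {x} {y} (v≢x , v≢y , x≢y) = begin
  ∣ (⁅ v ⁆ ∪ ⁅ x ⁆) ∪ ⁅ y ⁆ ∣ ≡⟨ ∣q∪⁅x⁆∣ (⁅ v ⁆ ∪ ⁅ x ⁆) y (lookup-⁅⁆∪⁅⁆-≢ v≢y x≢y) ⟩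
  suc ∣ ⁅ v ⁆ ∪ ⁅ x ⁆ ∣       ≡⟨ cong suc (∣q∪⁅x⁆∣ ⁅ v ⁆ x (lookup-⁅⁆-≢ v≢x)) ⟩
  suc (suc ∣ ⁅ v ⁆ ∣)         ≡⟨ cong (2 +_) (∣⁅x⁆∣≡1 v) ⟩
  3                           ∎
  where open ≡-Reasoning

∪-⊆ᵇ : ∀ {m} (p q r : Subset m) → (p ∪ q) ⊆ᵇ r ≡ p ⊆ᵇ r ∧ q ⊆ᵇ r
∪-⊆ᵇ []      []      []      = refl
∪-⊆ᵇ (s ∷ p) (t ∷ q) (u ∷ r) rewrite ∪-⊆ᵇ p q r = step s t u
  where
  step : ∀ s t u → (not (s ∨ t) ∨ u) ∧ (p ⊆ᵇ r ∧ q ⊆ᵇ r) ≡ ((not s ∨ u) ∧ p ⊆ᵇ r) ∧ ((not t ∨ u) ∧ q ⊆ᵇ r)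
  step true  true  true  = refl
  step true  false true  = refl
  step true  _     false = refl
  step false true  true  = refl
  step false true  false = sym (∧-zeroʳ (p ⊆ᵇ r))
  step false false _     = refl

⊥-⊆ᵇ : ∀ {m} (r : Subset m) → ⊥ ⊆ᵇ r ≡ true
⊥-⊆ᵇ []      = refl
⊥-⊆ᵇ (_ ∷ r) = ⊥-⊆ᵇ r

⁅⁆-⊆ᵇ : ∀ {m} (x : Fin m) (r : Subset m) → ⁅ x ⁆ ⊆ᵇ r ≡ lookup r x
⁅⁆-⊆ᵇ zero    (u ∷ r) = trans (cong (u ∧_) (⊥-⊆ᵇ r)) (∧-identityʳ u)
⁅⁆-⊆ᵇ (suc x) (_ ∷ r) = ⁅⁆-⊆ᵇ x r

triple-⊆ᵇ : ∀ {m} (v x y : Fin m) (T : Subset m) →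
  triple v x y ⊆ᵇ T ≡ (lookup T v ∧ lookup T x) ∧ lookup T y
triple-⊆ᵇ v x y T
  rewrite ∪-⊆ᵇ (⁅ v ⁆ ∪ ⁅ x ⁆) ⁅ y ⁆ T | ∪-⊆ᵇ ⁅ v ⁆ ⁅ x ⁆ T | ⁅⁆-⊆ᵇ v T | ⁅⁆-⊆ᵇ x T | ⁅⁆-⊆ᵇ y T = refl

∉triple⇒∉⁅v⁆ : ∀ {m} {v x y z : Fin m} → lookup (triple v x y) z ≡ false → lookup ⁅ v ⁆ z ≡ false
∉triple⇒∉⁅v⁆ {v = v} {x} {y} {z} z∉S = ∨-conicalˡ _ _ (trans (sym (lookup-∪ ⁅ v ⁆ ⁅ x ⁆ z))
  (∨-conicalˡ _ _ (trans (sym (lookup-∪ (⁅ v ⁆ ∪ ⁅ x ⁆) ⁅ y ⁆ z)) z∉S)))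

-- Double counting through a vertex

∑∑-product : ∀ {m} (f g : Fin m → ℕ) → sum (λ x → sum (λ y → f x * g y)) ≡ sum f * sum g
∑∑-product f g = begin
  sum (λ x → sum (λ y → f x * g y)) ≡⟨ sum-cong-≗ (λ x → *-distribˡ-sum (f x) g) ⟨
  sum (λ x → f x * sum g)           ≡⟨ *-distribʳ-sum (sum g) f ⟨
  sum f * sum g                     ∎
  where open ≡-Reasoning

∑∑-*ʳ : ∀ {m} (h : Fin m → Fin m → ℕ) c → sum (λ x → sum (λ y → h x y * c)) ≡ sum (λ x → sum (h x)) * c
∑∑-*ʳ h c = trans (sum-cong-≗ (λ x → sym (*-distribʳ-sum c (h x)))) (sym (*-distribʳ-sum c (λ x → sum (h x))))

∑∑-mono-≤ : ∀ {m} (X Y : Subset m) {f g : Fin m → Fin m → ℕ} → (∀ {x y} → x ∈ X → y ∈ Y → f x y ≤ g x y) →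
  sum (λ x → sum (λ y → (𝟙 (lookup X x) * 𝟙 (lookup Y y)) * f x y)) ≤
  sum (λ x → sum (λ y → (𝟙 (lookup X x) * 𝟙 (lookup Y y)) * g x y))
∑∑-mono-≤ X Y f≤g = sum-mono-≤ (λ x → sum-mono-≤ (λ y → pointwise x y))
  where
  pointwise : ∀ x y → (𝟙 (lookup X x) * 𝟙 (lookup Y y)) * _ ≤ (𝟙 (lookup X x) * 𝟙 (lookup Y y)) * _
  pointwise x y with lookup X x in x∈X | lookup Y y in y∈Y
  ... | false | _     = z≤n
  ... | true  | false = z≤n
  ... | true  | true  = *-monoʳ-≤ 1 (f≤g (lookup⇒[]= x X x∈X) (lookup⇒[]= y Y y∈Y))

∑∑-∣p∣*∣q∣ : ∀ {m} (X Y : Subset m) c →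
  sum (λ x → sum (λ y → (𝟙 (lookup X x) * 𝟙 (lookup Y y)) * c)) ≡ ∣ X ∣ * ∣ Y ∣ * c
∑∑-∣p∣*∣q∣ X Y c = begin
  sum (λ x → sum (λ y → (𝟙 (lookup X x) * 𝟙 (lookup Y y)) * c))
    ≡⟨ ∑∑-*ʳ (λ x y → 𝟙 (lookup X x) * 𝟙 (lookup Y y)) c ⟩
  sum (λ x → sum (λ y → 𝟙 (lookup X x) * 𝟙 (lookup Y y))) * c
    ≡⟨ cong (_* c) (∑∑-product (𝟙 ∘ lookup X) (𝟙 ∘ lookup Y)) ⟩
  sum (𝟙 ∘ lookup X) * sum (𝟙 ∘ lookup Y) * c
    ≡⟨ cong₂ (λ a b → a * b * c) (∣p∣≡∑ X) (∣p∣≡∑ Y) ⟨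
  ∣ X ∣ * ∣ Y ∣ * c ∎
  where open ≡-Reasoning

𝟙-∧₄ : ∀ a b c d g → 𝟙 (((a ∧ b) ∧ c) ∧ d) * g ≡ (𝟙 (a ∧ d) * g) * (𝟙 b * 𝟙 c)
𝟙-∧₄ false b     c     d g = refl
𝟙-∧₄ true  false c     d g = sym (*-zeroʳ (𝟙 d * g))
𝟙-∧₄ true  true  false d g = sym (*-zeroʳ (𝟙 d * g))
𝟙-∧₄ true  true  true  d g = sym (*-identityʳ (𝟙 d * g))

-- Each 4-set T ∋ v arises as {v,x,y} ∪ {z} from exactly ∣T ∩ X∣ · ∣T ∩ Y∣ pairs (x , y) ∈ X × Y.
double-count : ∀ {m} (v : Fin m) (X Y : Subset m) (G : Subset m → ℕ) →
  (∀ {x y} → x ∈ X → y ∈ Y → Distinct₃ v x y) →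
  sum (λ x → sum (λ y → (𝟙 (lookup X x) * 𝟙 (lookup Y y)) *
    sum (λ z → 𝟙 (not (lookup (triple v x y) z)) * G (triple v x y ∪ ⁅ z ⁆))))
  ≡ ∑ₛ (λ T → (𝟙 (lookup T v ∧ (∣ T ∣ ≡ᵇ 4)) * G T) * (∣ T ∩ X ∣ * ∣ T ∩ Y ∣))
double-count {m} v X Y G distinct = begin
  sum (λ x → sum (λ y → c x y * sum (λ z → 𝟙 (not (lookup (triple v x y) z)) * G (triple v x y ∪ ⁅ z ⁆))))
    ≡⟨ sum-cong-≗ (λ x → sum-cong-≗ (λ y →
         trans (cong (c x y *_) (∑-extensions (triple v x y) G)) (*-distribˡ-∑ₛ (c x y) (W x y)))) ⟩
  sum (λ x → sum (λ y → ∑ₛ (λ T → c x y * W x y T)))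
    ≡⟨ sum-cong-≗ (λ x → ∑ₛ-∑-comm (λ T y → c x y * W x y T)) ⟨
  sum (λ x → ∑ₛ (λ T → sum (λ y → c x y * W x y T)))
    ≡⟨ ∑ₛ-∑-comm (λ T x → sum (λ y → c x y * W x y T)) ⟨
  ∑ₛ (λ T → sum (λ x → sum (λ y → c x y * W x y T)))
    ≡⟨ ∑ₛ-cong per-set ⟩
  ∑ₛ (λ T → (𝟙 (lookup T v ∧ (∣ T ∣ ≡ᵇ 4)) * G T) * (∣ T ∩ X ∣ * ∣ T ∩ Y ∣)) ∎
  where
  open ≡-Reasoning
  c : Fin m → Fin m → ℕ
  c x y = 𝟙 (lookup X x) * 𝟙 (lookup Y y)
  W : Fin m → Fin m → Subset m → ℕ
  W x y T = 𝟙 (triple v x y ⊆ᵇ T ∧ (∣ T ∣ ≡ᵇ suc ∣ triple v x y ∣)) * G T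
  per-set : ∀ T → sum (λ x → sum (λ y → c x y * W x y T))
                ≡ (𝟙 (lookup T v ∧ (∣ T ∣ ≡ᵇ 4)) * G T) * (∣ T ∩ X ∣ * ∣ T ∩ Y ∣)
  per-set T = begin
    sum (λ x → sum (λ y → c x y * W x y T))
      ≡⟨ sum-cong-≗ (λ x → sum-cong-≗ (λ y → pointwise x y)) ⟩
    sum (λ x → sum (λ y → K * (f x * g y)))
      ≡⟨ sum-cong-≗ (λ x → *-distribˡ-sum K (λ y → f x * g y)) ⟨
    sum (λ x → K * sum (λ y → f x * g y))
      ≡⟨ *-distribˡ-sum K (λ x → sum (λ y → f x * g y)) ⟨
    K * sum (λ x → sum (λ y → f x * g y))
      ≡⟨ cong (K *_) (trans (∑∑-product f g) (sym (cong₂ _*_ (∣p∩q∣≡∑ T X) (∣p∩q∣≡∑ T Y)))) ⟩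
    K * (∣ T ∩ X ∣ * ∣ T ∩ Y ∣) ∎
    where
    K = 𝟙 (lookup T v ∧ (∣ T ∣ ≡ᵇ 4)) * G T
    f g : Fin m → ℕ
    f x = 𝟙 (lookup T x ∧ lookup X x)
    g y = 𝟙 (lookup T y ∧ lookup Y y)
    pointwise : ∀ x y → c x y * W x y T ≡ K * (f x * g y)
    pointwise x y with lookup X x in x∈X | lookup Y y in y∈Y
    ... | false | _     rewrite ∧-zeroʳ (lookup T x) = sym (*-zeroʳ K)
    ... | true  | false rewrite ∧-zeroʳ (lookup T y) | *-zeroʳ (𝟙 (lookup T x ∧ true)) = sym (*-zeroʳ K)
    ... | true  | true
      rewrite triple-⊆ᵇ v x y T | ∣triple∣ (distinct (lookup⇒[]= x X x∈X) (lookup⇒[]= y Y y∈Y))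
            | ∧-identityʳ (lookup T x) | ∧-identityʳ (lookup T y)
      = trans (*-identityˡ _) (𝟙-∧₄ (lookup T v) (lookup T x) (lookup T y) (∣ T ∣ ≡ᵇ 4) (G T))

≡ᵇ-cancelʳ : ∀ x y c → (x + c ≡ᵇ y + c) ≡ (x ≡ᵇ y)
≡ᵇ-cancelʳ x y c = trans (cong₂ _≡ᵇ_ (+-comm x c) (+-comm y c)) (cancel c)
  where
  cancel : ∀ c → (c + x ≡ᵇ c + y) ≡ (x ≡ᵇ y)
  cancel zero    = refl
  cancel (suc c) = cancel c

uniform⇒∣e∣≡4 : ∀ {m} {H : Hypergraph m} → Uniform4 H → ∀ {e} → H e ≡ true → ∣ e ∣ ≡ 4
uniform⇒∣e∣≡4 uniform {e} He = uniform e (subst T (sym He) _)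

degree : ∀ {m} → Hypergraph m → Subset m → Fin m → ℕ → ℕ
degree H A v j = ∑ₛ (λ T → 𝟙 (H T ∧ lookup T v ∧ (∣ T ∩ A ∣ ≡ᵇ j)))

linkCount≡degree : ∀ {m} {H : Hypergraph m} → Uniform4 H → (A : Subset m) (v : Fin m) (k : ℕ) →
  linkCount H A v k ≡ degree H A v (k + 𝟙 (lookup A v))
linkCount≡degree {m} {H} uniform A v k = begin
  linkCount H A v k
    ≡⟨ countSets≡∑ₛ (λ S → (∣ S ∣ ≡ᵇ 3) ∧ not ⌊ v ∈? S ⌋ ∧ H (S ∪ ⁅ v ⁆) ∧ (∣ S ∩ A ∣ ≡ᵇ k)) ⟩
  ∑ₛ (λ S → 𝟙 ((∣ S ∣ ≡ᵇ 3) ∧ not ⌊ v ∈? S ⌋ ∧ H (S ∪ ⁅ v ⁆) ∧ (∣ S ∩ A ∣ ≡ᵇ k)))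
    ≡⟨ ∑ₛ-cong link-term ⟩
  ∑ₛ (λ S → 𝟙 (not (lookup S v)) * G (S ∪ ⁅ v ⁆))
    ≡⟨ ∑ₛ-insert v G ⟩
  ∑ₛ (λ T → 𝟙 (lookup T v) * G T)
    ≡⟨ ∑ₛ-cong edge-term ⟩
  degree H A v (k + 𝟙 (lookup A v)) ∎
  where
  open ≡-Reasoning
  G : Subset m → ℕ
  G T = 𝟙 (H T ∧ (∣ T ∩ A ∣ ≡ᵇ k + 𝟙 (lookup A v)))
  -- When v ∉ S and S ∪ {v} is an edge, uniformity makes the condition ∣S∣ = 3 automatic.
  link-term : ∀ S → 𝟙 ((∣ S ∣ ≡ᵇ 3) ∧ not ⌊ v ∈? S ⌋ ∧ H (S ∪ ⁅ v ⁆) ∧ (∣ S ∩ A ∣ ≡ᵇ k))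
                  ≡ 𝟙 (not (lookup S v)) * G (S ∪ ⁅ v ⁆)
  link-term S rewrite does-∈? v S with lookup S v in v∈S
  ... | true = cong 𝟙 (∧-zeroʳ (∣ S ∣ ≡ᵇ 3))
  ... | false rewrite ∣[q∪⁅x⁆]∩p∣ S A v v∈S | ≡ᵇ-cancelʳ ∣ S ∩ A ∣ k (𝟙 (lookup A v))
    with H (S ∪ ⁅ v ⁆) in edge
  ...   | false = cong 𝟙 (∧-zeroʳ (∣ S ∣ ≡ᵇ 3))
  ...   | true rewrite suc-injective (trans (sym (∣q∪⁅x⁆∣ S v v∈S)) (uniform⇒∣e∣≡4 uniform edge))
    = sym (+-identityʳ _)
  edge-term : ∀ T → 𝟙 (lookup T v) * G T ≡ 𝟙 (H T ∧ lookup T v ∧ (∣ T ∩ A ∣ ≡ᵇ k + 𝟙 (lookup A v)))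
  edge-term T with lookup T v | H T
  ... | true  | true  = +-identityʳ _
  ... | true  | false = refl
  ... | false | h     = sym (cong 𝟙 (∧-zeroʳ h))

codeg3≡∑ : ∀ {m} (H : Hypergraph m) (S : Subset m) →
  codeg3 H S ≡ sum (λ z → 𝟙 (not (lookup S z)) * 𝟙 (H (S ∪ ⁅ z ⁆)))
codeg3≡∑ H S = trans (countB-tabulate (λ z → not ⌊ z ∈? S ⌋ ∧ H (S ∪ ⁅ z ⁆)) (λ z → z)) (sum-cong-≗ (λ z →
  trans (cong (λ b → 𝟙 (not b ∧ H (S ∪ ⁅ z ⁆))) (does-∈? z S)) (𝟙-∧ (not (lookup S z)) (H (S ∪ ⁅ z ⁆)))))

codegree-double-count-≥ : ∀ {m} {H : Hypergraph m} {d} → MinCodeg3≥ H d → (v : Fin m) (X Y : Subset m) →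
  (∀ {x y} → x ∈ X → y ∈ Y → Distinct₃ v x y) →
  ∣ X ∣ * ∣ Y ∣ * d ≤ ∑ₛ (λ T → (𝟙 (lookup T v ∧ (∣ T ∣ ≡ᵇ 4)) * 𝟙 (H T)) * (∣ T ∩ X ∣ * ∣ T ∩ Y ∣))
codegree-double-count-≥ {H = H} {d} δ≥d v X Y distinct = begin
  ∣ X ∣ * ∣ Y ∣ * d
    ≡⟨ ∑∑-∣p∣*∣q∣ X Y d ⟨
  sum (λ x → sum (λ y → (𝟙 (lookup X x) * 𝟙 (lookup Y y)) * d))
    ≤⟨ ∑∑-mono-≤ X Y (λ x∈X y∈Y → δ≥d _ (∣triple∣ (distinct x∈X y∈Y))) ⟩
  sum (λ x → sum (λ y → (𝟙 (lookup X x) * 𝟙 (lookup Y y)) * codeg3 H (triple v x y)))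
    ≡⟨ sum-cong-≗ (λ x → sum-cong-≗ (λ y → cong (𝟙 (lookup X x) * 𝟙 (lookup Y y) *_) (codeg3≡∑ H (triple v x y)))) ⟩
  sum (λ x → sum (λ y → (𝟙 (lookup X x) * 𝟙 (lookup Y y)) *
    sum (λ z → 𝟙 (not (lookup (triple v x y) z)) * 𝟙 (H (triple v x y ∪ ⁅ z ⁆)))))
    ≡⟨ double-count v X Y (𝟙 ∘ H) distinct ⟩
  ∑ₛ (λ T → (𝟙 (lookup T v ∧ (∣ T ∣ ≡ᵇ 4)) * 𝟙 (H T)) * (∣ T ∩ X ∣ * ∣ T ∩ Y ∣)) ∎
  where open ≤-Reasoning

extension-double-count-≤ : ∀ {m} (v : Fin m) (X Y : Subset m) (G : Subset m → ℕ) (c : ℕ) →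
  (∀ {x y} → x ∈ X → y ∈ Y → Distinct₃ v x y) →
  (∀ {x y} → x ∈ X → y ∈ Y → sum (λ z → 𝟙 (not (lookup (triple v x y) z)) * G (triple v x y ∪ ⁅ z ⁆)) ≤ c) →
  ∑ₛ (λ T → (𝟙 (lookup T v ∧ (∣ T ∣ ≡ᵇ 4)) * G T) * (∣ T ∩ X ∣ * ∣ T ∩ Y ∣)) ≤ ∣ X ∣ * ∣ Y ∣ * c
extension-double-count-≤ v X Y G c distinct ≤c = begin
  ∑ₛ (λ T → (𝟙 (lookup T v ∧ (∣ T ∣ ≡ᵇ 4)) * G T) * (∣ T ∩ X ∣ * ∣ T ∩ Y ∣))
    ≡⟨ double-count v X Y G distinct ⟨
  sum (λ x → sum (λ y → (𝟙 (lookup X x) * 𝟙 (lookup Y y)) *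
    sum (λ z → 𝟙 (not (lookup (triple v x y) z)) * G (triple v x y ∪ ⁅ z ⁆))))
    ≤⟨ ∑∑-mono-≤ X Y ≤c ⟩
  sum (λ x → sum (λ y → (𝟙 (lookup X x) * 𝟙 (lookup Y y)) * c))
    ≡⟨ ∑∑-∣p∣*∣q∣ X Y c ⟩
  ∣ X ∣ * ∣ Y ∣ * c ∎
  where open ≤-Reasoning

t+u≡3⇒t*u≡2*[𝟙[t≡1]+𝟙[t≡2]] : ∀ t u → t + u ≡ 3 → t * u ≡ 2 * (𝟙 (t ≡ᵇ 1) + 𝟙 (t ≡ᵇ 2))
t+u≡3⇒t*u≡2*[𝟙[t≡1]+𝟙[t≡2]] 0 u refl = refl
t+u≡3⇒t*u≡2*[𝟙[t≡1]+𝟙[t≡2]] 1 u refl = refl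
t+u≡3⇒t*u≡2*[𝟙[t≡1]+𝟙[t≡2]] 2 u refl = refl
t+u≡3⇒t*u≡2*[𝟙[t≡1]+𝟙[t≡2]] 3 u refl = refl

module _ {m} {H : Hypergraph m} (uniform : Uniform4 H) (A : Subset m) where

  -- Each pair x ∈ A, y ∈ B - b spans with b a 3-set of codegree at least d, and an edge T ∋ b is counted
  -- ∣T ∩ A∣ · ∣T ∩ (B - b)∣ times: twice if it meets A in one or two vertices, never otherwise.
  degree-lower-bound : ∀ {d} → MinCodeg3≥ H d → ∀ {b} → b ∈ ∁ A →
    ∣ A ∣ * ∣ ∁ A - b ∣ * d ≤ 2 * (degree H A b 1 + degree H A b 2)
  degree-lower-bound {d} δ≥d {b} b∈B = begin
    ∣ A ∣ * ∣ ∁ A - b ∣ * d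
      ≤⟨ codegree-double-count-≥ δ≥d b A (∁ A - b) distinct ⟩
    ∑ₛ (λ T → (𝟙 (lookup T b ∧ (∣ T ∣ ≡ᵇ 4)) * 𝟙 (H T)) * (∣ T ∩ A ∣ * ∣ T ∩ (∁ A - b) ∣))
      ≡⟨ ∑ₛ-cong per-edge ⟩
    ∑ₛ (λ T → 2 * (d₁ T + d₂ T))
      ≡⟨ *-distribˡ-∑ₛ 2 (λ T → d₁ T + d₂ T) ⟨
    2 * ∑ₛ (λ T → d₁ T + d₂ T)
      ≡⟨ cong (2 *_) (∑ₛ-distrib-+ d₁ d₂) ⟩
    2 * (degree H A b 1 + degree H A b 2) ∎
    where
    open ≤-Reasoning
    d₁ d₂ : Subset m → ℕ
    d₁ T = 𝟙 (H T ∧ lookup T b ∧ (∣ T ∩ A ∣ ≡ᵇ 1))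
    d₂ T = 𝟙 (H T ∧ lookup T b ∧ (∣ T ∩ A ∣ ≡ᵇ 2))
    distinct : ∀ {x y} → x ∈ A → y ∈ ∁ A - b → Distinct₃ b x y
    distinct x∈A y∈B-b = ≢-sym (x∈p∧y∈∁p⇒x≢y x∈A b∈B) , y∈p-x⇒x≢y (∁ A) y∈B-b
                       , x∈p∧y∈∁p⇒x≢y x∈A (p─q⊆p (∁ A) ⁅ b ⁆ y∈B-b)
    per-edge : ∀ T → (𝟙 (lookup T b ∧ (∣ T ∣ ≡ᵇ 4)) * 𝟙 (H T)) * (∣ T ∩ A ∣ * ∣ T ∩ (∁ A - b) ∣)
                   ≡ 2 * (d₁ T + d₂ T)
    per-edge T with H T in edge
    ... | false rewrite *-zeroʳ (𝟙 (lookup T b ∧ (∣ T ∣ ≡ᵇ 4))) = refl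
    ... | true with lookup T b in b∈T
    ...   | false = refl
    ...   | true rewrite uniform⇒∣e∣≡4 uniform edge =
      trans (+-identityʳ _) (t+u≡3⇒t*u≡2*[𝟙[t≡1]+𝟙[t≡2]] ∣ T ∩ A ∣ ∣ T ∩ (∁ A - b) ∣ (suc-injective (begin-equality
        suc (∣ T ∩ A ∣ + ∣ T ∩ (∁ A - b) ∣)              ≡⟨ +-suc _ _ ⟨
        ∣ T ∩ A ∣ + suc ∣ T ∩ (∁ A - b) ∣                ≡⟨ cong (λ t → ∣ T ∩ A ∣ + (𝟙 t + ∣ T ∩ (∁ A - b) ∣)) b∈T ⟨
        ∣ T ∩ A ∣ + (𝟙 (lookup T b) + ∣ T ∩ (∁ A - b) ∣) ≡⟨ cong (∣ T ∩ A ∣ +_) (∣p∩[q-x]∣ T b∈B) ⟩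
        ∣ T ∩ A ∣ + ∣ T ∩ ∁ A ∣                          ≡⟨ ∣p∩q∣+∣p∩∁q∣≡∣p∣ T A ⟩
        ∣ T ∣                                            ≡⟨ uniform⇒∣e∣≡4 uniform edge ⟩
        4                                                ∎)))

  degree-upper-bound : ∀ {a} → a ∈ A → 2 * degree H A a 3 ≤ ∣ A - a ∣ * ∣ ∁ A ∣ * ∣ A - a ∣
  degree-upper-bound {a} a∈A = begin
    2 * degree H A a 3
      ≡⟨ *-distribˡ-∑ₛ 2 (λ T → 𝟙 (H T ∧ lookup T a ∧ (∣ T ∩ A ∣ ≡ᵇ 3))) ⟩
    ∑ₛ (λ T → 2 * 𝟙 (H T ∧ lookup T a ∧ (∣ T ∩ A ∣ ≡ᵇ 3)))
      ≡⟨ ∑ₛ-cong per-edge ⟩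
    ∑ₛ (λ T → (𝟙 (lookup T a ∧ (∣ T ∣ ≡ᵇ 4)) * G T) * (∣ T ∩ (A - a) ∣ * ∣ T ∩ ∁ A ∣))
      ≤⟨ extension-double-count-≤ a (A - a) (∁ A) G ∣ A - a ∣ distinct few-extensions ⟩
    ∣ A - a ∣ * ∣ ∁ A ∣ * ∣ A - a ∣ ∎
    where
    open ≤-Reasoning
    G : Subset m → ℕ
    G T = 𝟙 (H T ∧ (∣ T ∩ A ∣ ≡ᵇ 3))
    distinct : ∀ {x y} → x ∈ A - a → y ∈ ∁ A → Distinct₃ a x y
    distinct x∈A-a y∈B = y∈p-x⇒x≢y A x∈A-a , x∈p∧y∈∁p⇒x≢y a∈A y∈B
                       , x∈p∧y∈∁p⇒x≢y (p─q⊆p A ⁅ a ⁆ x∈A-a) y∈B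
    per-edge : ∀ T → 2 * 𝟙 (H T ∧ lookup T a ∧ (∣ T ∩ A ∣ ≡ᵇ 3))
                   ≡ (𝟙 (lookup T a ∧ (∣ T ∣ ≡ᵇ 4)) * G T) * (∣ T ∩ (A - a) ∣ * ∣ T ∩ ∁ A ∣)
    per-edge T with H T in edge
    ... | false rewrite *-zeroʳ (𝟙 (lookup T a ∧ (∣ T ∣ ≡ᵇ 4))) = refl
    ... | true with lookup T a in a∈T
    ...   | false = refl
    ...   | true rewrite uniform⇒∣e∣≡4 uniform edge with ∣ T ∩ A ∣ ≡ᵇ 3 in three
    ...     | false = refl
    ...     | true rewrite suc-injective (trans (cong (λ t → 𝟙 t + ∣ T ∩ (A - a) ∣) (sym a∈T))
                                           (trans (∣p∩[q-x]∣ T a∈A) (≡ᵇ≡true⇒≡ three)))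
                        | +-cancelˡ-≡ 3 ∣ T ∩ ∁ A ∣ 1 (trans (cong (_+ ∣ T ∩ ∁ A ∣) (sym (≡ᵇ≡true⇒≡ three)))
                            (trans (∣p∩q∣+∣p∩∁q∣≡∣p∣ T A) (uniform⇒∣e∣≡4 uniform edge))) = refl
    -- Given a ∈ A, x ∈ A - a and y ∈ B, only z ∈ A - a completes {a,x,y} to a set with three vertices in A.
    few-extensions : ∀ {x y} → x ∈ A - a → y ∈ ∁ A →
      sum (λ z → 𝟙 (not (lookup (triple a x y) z)) * G (triple a x y ∪ ⁅ z ⁆)) ≤ ∣ A - a ∣
    few-extensions {x} {y} x∈A-a y∈B = begin
      sum (λ z → 𝟙 (not (lookup (triple a x y) z)) * G (triple a x y ∪ ⁅ z ⁆))
        ≤⟨ sum-mono-≤ pointwise ⟩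
      sum (𝟙 ∘ lookup (A - a))
        ≡⟨ ∣p∣≡∑ (A - a) ⟨
      ∣ A - a ∣ ∎
      where
      at-most-one : ∀ h t → 1 * 𝟙 (h ∧ (2 + 𝟙 t ≡ᵇ 3)) ≤ 𝟙 t
      at-most-one true  true  = ≤-refl
      at-most-one false true  = z≤n
      at-most-one true  false = z≤n
      at-most-one false false = z≤n
      pointwise : ∀ z → 𝟙 (not (lookup (triple a x y) z)) * G (triple a x y ∪ ⁅ z ⁆) ≤ 𝟙 (lookup (A - a) z)
      pointwise z with lookup (triple a x y) z in z∉S
      ... | true = z≤n
      ... | false
        rewrite ∣[q∪⁅x⁆]∩p∣ (triple a x y) A z z∉S | ∣triple∩p∣ A (distinct x∈A-a y∈B)
              | []=⇒lookup a∈A | []=⇒lookup (p─q⊆p A ⁅ a ⁆ x∈A-a) | x∈∁p⇒lookup≡false y∈B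
              | lookup-─ A ⁅ a ⁆ z (∉triple⇒∉⁅v⁆ {v = a} {x} {y} {z} z∉S)
        = at-most-one (H (triple a x y ∪ ⁅ z ⁆)) (lookup A z)

degree-avoiding : ∀ {m} → Hypergraph m → Subset m → Fin m → Fin m → ℕ → ℕ
degree-avoiding H A v w j = ∑ₛ (λ T → 𝟙 (H T ∧ lookup T v ∧ not (lookup T w) ∧ (∣ T ∩ A ∣ ≡ᵇ j)))

codegree₂ : ∀ {m} → Hypergraph m → Fin m → Fin m → ℕ
codegree₂ H v w = ∑ₛ (λ T → 𝟙 (H T ∧ lookup T v ∧ lookup T w))

degree-avoiding≤degree : ∀ {m} (H : Hypergraph m) A (v w : Fin m) j → degree-avoiding H A v w j ≤ degree H A v j
degree-avoiding≤degree H A v w j = ∑ₛ-mono-≤ pointwise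
  where
  pointwise : ∀ T → 𝟙 (H T ∧ lookup T v ∧ not (lookup T w) ∧ (∣ T ∩ A ∣ ≡ᵇ j))
                  ≤ 𝟙 (H T ∧ lookup T v ∧ (∣ T ∩ A ∣ ≡ᵇ j))
  pointwise T with H T | lookup T v | lookup T w
  ... | false | _     | _     = z≤n
  ... | true  | false | _     = z≤n
  ... | true  | true  | true  = z≤n
  ... | true  | true  | false = ≤-refl

degree≤degree-avoiding+codegree₂ : ∀ {m} (H : Hypergraph m) A (v w : Fin m) j →
  degree H A v j ≤ degree-avoiding H A v w j + codegree₂ H v w
degree≤degree-avoiding+codegree₂ {m} H A v w j =
  ≤-trans (∑ₛ-mono-≤ pointwise) (≤-reflexive (∑ₛ-distrib-+ {m} _ _))
  where
  pointwise : ∀ T → 𝟙 (H T ∧ lookup T v ∧ (∣ T ∩ A ∣ ≡ᵇ j))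
                  ≤ 𝟙 (H T ∧ lookup T v ∧ not (lookup T w) ∧ (∣ T ∩ A ∣ ≡ᵇ j)) + 𝟙 (H T ∧ lookup T v ∧ lookup T w)
  pointwise T with H T | lookup T v | lookup T w | ∣ T ∩ A ∣ ≡ᵇ j
  ... | false | _     | _     | _     = z≤n
  ... | true  | false | _     | _     = z≤n
  ... | true  | true  | true  | false = z≤n
  ... | true  | true  | true  | true  = s≤s z≤n
  ... | true  | true  | false | _     = ≤-reflexive (sym (+-identityʳ _))

∑ₛ-size≡k≤m^k : ∀ m k → ∑ₛ {m} (λ R → 𝟙 (∣ R ∣ ≡ᵇ k)) ≤ m ^ k
∑ₛ-size≡k≤m^k zero    zero    = ≤-refl
∑ₛ-size≡k≤m^k zero    (suc k) = z≤n
∑ₛ-size≡k≤m^k (suc m) zero    rewrite ∑ₛ-zero {m} = ∑ₛ-size≡k≤m^k m zero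
∑ₛ-size≡k≤m^k (suc m) (suc k) = +-mono-≤
  (≤-trans (∑ₛ-size≡k≤m^k m k) (^-monoˡ-≤ k (n≤1+n m)))
  (≤-trans (∑ₛ-size≡k≤m^k m (suc k)) (*-monoʳ-≤ m (^-monoˡ-≤ k (n≤1+n m))))

-- An edge through v and w is {v, w} ∪ R for a 2-set R.
codegree₂≤m^2 : ∀ {m} {H : Hypergraph m} → Uniform4 H → ∀ {v w : Fin m} → v ≢ w → codegree₂ H v w ≤ m ^ 2
codegree₂≤m^2 {m} {H} uniform {v} {w} v≢w = begin
  codegree₂ H v w                                  ≤⟨ ∑ₛ-mono-≤ edge⇒4-set ⟩
  ∑ₛ (λ T → 𝟙 (lookup T v) * G₄ T)                 ≡⟨ ∑ₛ-insert v G₄ ⟨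
  ∑ₛ (λ S → 𝟙 (not (lookup S v)) * G₄ (S ∪ ⁅ v ⁆)) ≤⟨ ∑ₛ-mono-≤ drop-v ⟩
  ∑ₛ (λ S → 𝟙 (lookup S w) * G₃ S)                 ≡⟨ ∑ₛ-insert w G₃ ⟨
  ∑ₛ (λ R → 𝟙 (not (lookup R w)) * G₃ (R ∪ ⁅ w ⁆)) ≤⟨ ∑ₛ-mono-≤ drop-w ⟩
  ∑ₛ {m} (λ R → 𝟙 (∣ R ∣ ≡ᵇ 2))                    ≤⟨ ∑ₛ-size≡k≤m^k m 2 ⟩
  m ^ 2                                            ∎
  where
  open ≤-Reasoning
  G₄ G₃ : Subset m → ℕ
  G₄ T = 𝟙 (lookup T w ∧ (∣ T ∣ ≡ᵇ 4))
  G₃ S = 𝟙 (∣ S ∣ ≡ᵇ 3)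
  edge⇒4-set : ∀ T → 𝟙 (H T ∧ lookup T v ∧ lookup T w) ≤ 𝟙 (lookup T v) * G₄ T
  edge⇒4-set T with H T in edge
  ... | false = z≤n
  ... | true rewrite uniform⇒∣e∣≡4 uniform edge with lookup T v | lookup T w
  ...   | true  | true  = ≤-refl
  ...   | true  | false = z≤n
  ...   | false | _     = z≤n
  drop-v : ∀ S → 𝟙 (not (lookup S v)) * G₄ (S ∪ ⁅ v ⁆) ≤ 𝟙 (lookup S w) * G₃ S
  drop-v S with lookup S v in v∉S
  ... | true = z≤n
  ... | false rewrite ∣q∪⁅x⁆∣ S v v∉S | lookup-∪ S ⁅ v ⁆ w | lookup-⁅⁆-≢ v≢w with lookup S w
  ...   | true  = ≤-refl
  ...   | false = z≤n
  drop-w : ∀ R → 𝟙 (not (lookup R w)) * G₃ (R ∪ ⁅ w ⁆) ≤ 𝟙 (∣ R ∣ ≡ᵇ 2)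
  drop-w R with lookup R w in w∉R
  ... | true = z≤n
  ... | false rewrite ∣q∪⁅x⁆∣ R w w∉R = ≤-reflexive (+-identityʳ _)

-- Swapping a vertex of A with a vertex of B

-- Moving a from A to B and b from B to A only changes the position of edges containing exactly one of a, b.
swap-term : ∀ h α β e e′ → e′ + 𝟙 α ≡ e + 𝟙 β →
  𝟙 (h ∧ (e′ ≡ᵇ 2)) + (𝟙 (h ∧ α ∧ not β ∧ (e ≡ᵇ 2)) + 𝟙 (h ∧ β ∧ not α ∧ (e ≡ᵇ 2)))
  ≡ 𝟙 (h ∧ (e ≡ᵇ 2)) + (𝟙 (h ∧ α ∧ not β ∧ (e ≡ᵇ 3)) + 𝟙 (h ∧ β ∧ not α ∧ (e ≡ᵇ 1)))
swap-term false α     β     e e′ _  = refl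
swap-term true  true  true  e e′ eq rewrite +-cancelʳ-≡ 1 e′ e eq = refl
swap-term true  false false e e′ eq rewrite +-cancelʳ-≡ 0 e′ e eq = refl
swap-term true  true  false e e′ eq rewrite trans (sym (+-identityʳ e)) (trans (sym eq) (+-comm e′ 1)) =
  trans (cong (a +_) (+-identityʳ b)) (trans (+-comm a b) (cong (b +_) (sym (+-identityʳ a))))
  where a = 𝟙 (e′ ≡ᵇ 2); b = 𝟙 (e′ ≡ᵇ 1)
swap-term true  false true  e e′ eq rewrite trans (sym (+-identityʳ e′)) (trans eq (+-comm e 1)) =
  +-comm (𝟙 (e ≡ᵇ 1)) (𝟙 (e ≡ᵇ 2))

module _ {m} (H : Hypergraph m) {A : Subset m} {a b : Fin m} (a∈A : a ∈ A) (b∈B : b ∈ ∁ A) where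

  ∣E∩[[A-a]∪⁅b⁆]∣ : ∀ E → ∣ E ∩ ((A - a) ∪ ⁅ b ⁆) ∣ + 𝟙 (lookup E a) ≡ ∣ E ∩ A ∣ + 𝟙 (lookup E b)
  ∣E∩[[A-a]∪⁅b⁆]∣ E = begin
    ∣ E ∩ ((A - a) ∪ ⁅ b ⁆) ∣ + 𝟙 (lookup E a)
      ≡⟨ cong (λ r → ∣ r ∣ + 𝟙 (lookup E a)) (∩-comm E ((A - a) ∪ ⁅ b ⁆)) ⟩
    ∣ ((A - a) ∪ ⁅ b ⁆) ∩ E ∣ + 𝟙 (lookup E a)
      ≡⟨ cong (_+ 𝟙 (lookup E a)) (∣[q∪⁅x⁆]∩p∣ (A - a) E b b∉A-a) ⟩
    ∣ (A - a) ∩ E ∣ + 𝟙 (lookup E b) + 𝟙 (lookup E a)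
      ≡⟨ cong (λ r → ∣ r ∣ + 𝟙 (lookup E b) + 𝟙 (lookup E a)) (∩-comm (A - a) E) ⟩
    ∣ E ∩ (A - a) ∣ + 𝟙 (lookup E b) + 𝟙 (lookup E a)
      ≡⟨ xy∙z≈zx∙y ∣ E ∩ (A - a) ∣ (𝟙 (lookup E b)) (𝟙 (lookup E a)) ⟩
    𝟙 (lookup E a) + ∣ E ∩ (A - a) ∣ + 𝟙 (lookup E b)
      ≡⟨ cong (_+ 𝟙 (lookup E b)) (∣p∩[q-x]∣ E a∈A) ⟩
    ∣ E ∩ A ∣ + 𝟙 (lookup E b) ∎
    where
    open ≡-Reasoning
    b∉A-a : lookup (A - a) b ≡ false
    b∉A-a = trans (lookup-─ A ⁅ a ⁆ b (lookup-⁅⁆-≢ (x∈p∧y∈∁p⇒x≢y a∈A b∈B))) (x∈∁p⇒lookup≡false b∈B)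

  ∣[A-a]∪⁅b⁆∣ : ∣ (A - a) ∪ ⁅ b ⁆ ∣ ≡ ∣ A ∣
  ∣[A-a]∪⁅b⁆∣ = +-cancelʳ-≡ 1 _ _ (begin
    ∣ (A - a) ∪ ⁅ b ⁆ ∣ + 1
      ≡⟨ cong₂ (λ r t → ∣ r ∣ + 𝟙 t) (∩-identityˡ ((A - a) ∪ ⁅ b ⁆)) (lookup-replicate a true) ⟨
    ∣ ⊤ ∩ ((A - a) ∪ ⁅ b ⁆) ∣ + 𝟙 (lookup ⊤ a)
      ≡⟨ ∣E∩[[A-a]∪⁅b⁆]∣ ⊤ ⟩
    ∣ ⊤ ∩ A ∣ + 𝟙 (lookup ⊤ b)
      ≡⟨ cong₂ (λ r t → ∣ r ∣ + 𝟙 t) (∩-identityˡ A) (lookup-replicate b true) ⟩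
    ∣ A ∣ + 1 ∎)
    where open ≡-Reasoning

  ∣∁[[A-a]∪⁅b⁆]∣ : ∣ ∁ ((A - a) ∪ ⁅ b ⁆) ∣ ≡ ∣ ∁ A ∣
  ∣∁[[A-a]∪⁅b⁆]∣ =
    trans (∣∁p∣≡n∸∣p∣ ((A - a) ∪ ⁅ b ⁆)) (trans (cong (m ∸_) ∣[A-a]∪⁅b⁆∣) (sym (∣∁p∣≡n∸∣p∣ A)))

  cross-after-swap :
    crossAABB H ((A - a) ∪ ⁅ b ⁆) + (degree-avoiding H A a b 2 + degree-avoiding H A b a 2)
    ≡ crossAABB H A + (degree-avoiding H A a b 3 + degree-avoiding H A b a 1)
  cross-after-swap = begin
    crossAABB H ((A - a) ∪ ⁅ b ⁆) + (degree-avoiding H A a b 2 + degree-avoiding H A b a 2)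
      ≡⟨ cong₂ _+_ (countSets≡∑ₛ (cross ((A - a) ∪ ⁅ b ⁆))) (sym (∑ₛ-distrib-+ (xa 2) (xb 2))) ⟩
    ∑ₛ (𝟙 ∘ cross ((A - a) ∪ ⁅ b ⁆)) + ∑ₛ (λ E → xa 2 E + xb 2 E)
      ≡⟨ ∑ₛ-distrib-+ (𝟙 ∘ cross ((A - a) ∪ ⁅ b ⁆)) (λ E → xa 2 E + xb 2 E) ⟨
    ∑ₛ (λ E → 𝟙 (cross ((A - a) ∪ ⁅ b ⁆) E) + (xa 2 E + xb 2 E))
      ≡⟨ ∑ₛ-cong (λ E → swap-term (H E) (lookup E a) (lookup E b) ∣ E ∩ A ∣ ∣ E ∩ ((A - a) ∪ ⁅ b ⁆) ∣
                          (∣E∩[[A-a]∪⁅b⁆]∣ E)) ⟩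
    ∑ₛ (λ E → 𝟙 (cross A E) + (xa 3 E + xb 1 E))
      ≡⟨ ∑ₛ-distrib-+ (𝟙 ∘ cross A) (λ E → xa 3 E + xb 1 E) ⟩
    ∑ₛ (𝟙 ∘ cross A) + ∑ₛ (λ E → xa 3 E + xb 1 E)
      ≡⟨ cong₂ _+_ (sym (countSets≡∑ₛ (cross A))) (∑ₛ-distrib-+ (xa 3) (xb 1)) ⟩
    crossAABB H A + (degree-avoiding H A a b 3 + degree-avoiding H A b a 1) ∎
    where
    open ≡-Reasoning
    cross : Subset m → Subset m → Bool
    cross A′ E = H E ∧ (∣ E ∩ A′ ∣ ≡ᵇ 2)
    xa xb : ℕ → Subset m → ℕ
    xa j E = 𝟙 (H E ∧ lookup E a ∧ not (lookup E b) ∧ (∣ E ∩ A ∣ ≡ᵇ j))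
    xb j E = 𝟙 (H E ∧ lookup E b ∧ not (lookup E a) ∧ (∣ E ∩ A ∣ ≡ᵇ j))

  swap-inequality : crossAABB H A ≤ crossAABB H ((A - a) ∪ ⁅ b ⁆) →
    degree H A a 2 + degree H A b 2 ≤ degree H A a 3 + degree H A b 1 + (codegree₂ H a b + codegree₂ H b a)
  swap-inequality minimal = begin
    degree H A a 2 + degree H A b 2
      ≤⟨ +-mono-≤ (degree≤degree-avoiding+codegree₂ H A a b 2) (degree≤degree-avoiding+codegree₂ H A b a 2) ⟩
    (Xa 2 + codegree₂ H a b) + (Xb 2 + codegree₂ H b a)
      ≡⟨ +-interchange (Xa 2) (codegree₂ H a b) (Xb 2) (codegree₂ H b a) ⟩
    (Xa 2 + Xb 2) + (codegree₂ H a b + codegree₂ H b a)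
      ≤⟨ +-monoˡ-≤ _ (+-cancelˡ-≤ (crossAABB H A) (Xa 2 + Xb 2) (Xa 3 + Xb 1)
           (≤-trans (+-monoˡ-≤ (Xa 2 + Xb 2) minimal) (≤-reflexive cross-after-swap))) ⟩
    (Xa 3 + Xb 1) + (codegree₂ H a b + codegree₂ H b a)
      ≤⟨ +-monoˡ-≤ _ (+-mono-≤ (degree-avoiding≤degree H A a b 3) (degree-avoiding≤degree H A b a 1)) ⟩
    degree H A a 3 + degree H A b 1 + (codegree₂ H a b + codegree₂ H b a) ∎
    where
    open ≤-Reasoning
    Xa Xb : ℕ → ℕ
    Xa = degree-avoiding H A a b
    Xb = degree-avoiding H A b a

degree-transfer : ∀ {k} {H : Hypergraph (suc k + suc k)} → Uniform4 H → MinCodeg3≥ H k →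
  ∀ {A} → IsMinPartition H (suc k) A → ∀ {a b} → a ∈ A → b ∈ ∁ A →
  degree H A a 2 ≤ 2 * degree H A b 1 + (codegree₂ H a b + codegree₂ H b a)
degree-transfer {k} {H} uniform δ≥k {A} (∣A∣≡n , ∣B∣≡n , minimal) {a} {b} a∈A b∈B =
  +-cancelʳ-≤ b₂ a₂ (2 * b₁ + c) (begin
    a₂ + b₂           ≤⟨ swap-inequality H a∈A b∈B (minimal ((A - a) ∪ ⁅ b ⁆)
                           (trans (∣[A-a]∪⁅b⁆∣ H a∈A b∈B) ∣A∣≡n) (trans (∣∁[[A-a]∪⁅b⁆]∣ H a∈A b∈B) ∣B∣≡n)) ⟩
    a₃ + b₁ + c       ≤⟨ +-monoˡ-≤ c (+-monoˡ-≤ b₁ a₃≤b₁+b₂) ⟩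
    b₁ + b₂ + b₁ + c  ≡⟨ solve 3 (λ x y z → x :+ y :+ x :+ z := con 2 :* x :+ z :+ y) refl b₁ b₂ c ⟩
    2 * b₁ + c + b₂   ∎)
  where
  open ≤-Reasoning
  a₂ a₃ b₁ b₂ c : ℕ
  a₂ = degree H A a 2
  a₃ = degree H A a 3
  b₁ = degree H A b 1
  b₂ = degree H A b 2
  c  = codegree₂ H a b + codegree₂ H b a
  ∣A-a∣≡k : ∣ A - a ∣ ≡ k
  ∣A-a∣≡k = suc-injective (trans (∣p-x∣ a∈A) ∣A∣≡n)
  ∣B-b∣≡k : ∣ ∁ A - b ∣ ≡ k
  ∣B-b∣≡k = suc-injective (trans (∣p-x∣ b∈B) ∣B∣≡n)
  a₃≤b₁+b₂ : a₃ ≤ b₁ + b₂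
  a₃≤b₁+b₂ = *-cancelˡ-≤ 2 (begin
    2 * a₃                          ≤⟨ degree-upper-bound uniform A a∈A ⟩
    ∣ A - a ∣ * ∣ ∁ A ∣ * ∣ A - a ∣ ≡⟨ cong₂ (λ x y → x * y * x) ∣A-a∣≡k ∣B∣≡n ⟩
    k * suc k * k                   ≡⟨ cong (_* k) (*-comm k (suc k)) ⟩
    suc k * k * k                   ≡⟨ cong₂ (λ x y → x * y * k) ∣A∣≡n ∣B-b∣≡k ⟨
    ∣ A ∣ * ∣ ∁ A - b ∣ * k         ≤⟨ degree-lower-bound uniform A δ≥k b∈B ⟩
    2 * (b₁ + b₂)                   ∎)

-- Complementing the partition

a+c≡3⇒[c≡1]≡[a≡2] : ∀ a c → a + c ≡ 3 → (c ≡ᵇ 1) ≡ (a ≡ᵇ 2)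
a+c≡3⇒[c≡1]≡[a≡2] 0 c refl = refl
a+c≡3⇒[c≡1]≡[a≡2] 1 c refl = refl
a+c≡3⇒[c≡1]≡[a≡2] 2 c refl = refl
a+c≡3⇒[c≡1]≡[a≡2] 3 c refl = refl

a+c≡4⇒[c≡2]≡[a≡2] : ∀ a c → a + c ≡ 4 → (c ≡ᵇ 2) ≡ (a ≡ᵇ 2)
a+c≡4⇒[c≡2]≡[a≡2] 0 c refl = refl
a+c≡4⇒[c≡2]≡[a≡2] 1 c refl = refl
a+c≡4⇒[c≡2]≡[a≡2] 2 c refl = refl
a+c≡4⇒[c≡2]≡[a≡2] 3 c refl = refl
a+c≡4⇒[c≡2]≡[a≡2] 4 c refl = refl

countSets-cong : ∀ {m} {p q : Subset m → Bool} → (∀ S → p S ≡ q S) → countSets p ≡ countSets q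
countSets-cong {p = p} {q} p≗q =
  trans (countSets≡∑ₛ p) (trans (∑ₛ-cong (cong 𝟙 ∘ p≗q)) (sym (countSets≡∑ₛ q)))

lABB-∁ : ∀ {m} (H : Hypergraph m) (A : Subset m) (v : Fin m) → lABB H (∁ A) v ≡ lAAB H A v
lABB-∁ H A v = countSets-cong triple-term
  where
  triple-term : ∀ S → (∣ S ∣ ≡ᵇ 3) ∧ not ⌊ v ∈? S ⌋ ∧ H (S ∪ ⁅ v ⁆) ∧ (∣ S ∩ ∁ A ∣ ≡ᵇ 1)
                    ≡ (∣ S ∣ ≡ᵇ 3) ∧ not ⌊ v ∈? S ⌋ ∧ H (S ∪ ⁅ v ⁆) ∧ (∣ S ∩ A ∣ ≡ᵇ 2)
  triple-term S with ∣ S ∣ ≡ᵇ 3 in three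
  ... | false = refl
  ... | true  = cong (λ t → not ⌊ v ∈? S ⌋ ∧ H (S ∪ ⁅ v ⁆) ∧ t)
    (a+c≡3⇒[c≡1]≡[a≡2] ∣ S ∩ A ∣ ∣ S ∩ ∁ A ∣ (trans (∣p∩q∣+∣p∩∁q∣≡∣p∣ S A) (≡ᵇ≡true⇒≡ three)))

crossAABB-∁ : ∀ {m} {H : Hypergraph m} → Uniform4 H → (A : Subset m) → crossAABB H (∁ A) ≡ crossAABB H A
crossAABB-∁ {H = H} uniform A = countSets-cong edge-term
  where
  edge-term : ∀ E → H E ∧ (∣ E ∩ ∁ A ∣ ≡ᵇ 2) ≡ H E ∧ (∣ E ∩ A ∣ ≡ᵇ 2)
  edge-term E with H E in edge
  ... | false = refl
  ... | true  = a+c≡4⇒[c≡2]≡[a≡2] ∣ E ∩ A ∣ ∣ E ∩ ∁ A ∣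
    (trans (∣p∩q∣+∣p∩∁q∣≡∣p∣ E A) (uniform⇒∣e∣≡4 uniform edge))

minPartition-∁ : ∀ {n} {H : Hypergraph (n + n)} → Uniform4 H → ∀ {A} → IsMinPartition H n A → IsMinPartition H n (∁ A)
minPartition-∁ {H = H} uniform {A} (∣A∣≡n , ∣∁A∣≡n , minimal) =
  ∣∁A∣≡n , trans (cong ∣_∣ (∁-involutive A)) ∣A∣≡n , λ A′ ∣A′∣≡n ∣∁A′∣≡n → begin
    crossAABB H (∁ A)    ≡⟨ crossAABB-∁ uniform A ⟩
    crossAABB H A        ≤⟨ minimal (∁ A′) ∣∁A′∣≡n (trans (cong ∣_∣ (∁-involutive A′)) ∣A′∣≡n) ⟩
    crossAABB H (∁ A′)   ≡⟨ crossAABB-∁ uniform A′ ⟩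
    crossAABB H A′       ∎
  where open ≤-Reasoning

module _ {m} (H : Hypergraph m) (A : Subset m) (ε : ℚ) where

  thrABB-∁ : thrABB ε (∁ A) ≡ thrAAB ε A
  thrABB-∁ = cong (λ t → ε ℚ.* toQ t)
    (trans (cong (λ p → ∣ ∁ A ∣ * (∣ p ∣ C 2)) (∁-involutive A)) (*-comm ∣ ∁ A ∣ (∣ A ∣ C 2)))

  anarchist-∁ : ∀ {a} → AnarchistA H A ε a → AnarchistB H (∁ A) ε a
  anarchist-∁ {a} = subst₂ ℚ._≤_ (cong toQ (sym (lABB-∁ H A a))) (sym thrABB-∁)

  typical-∁ : ∀ {b} → TypicalA H (∁ A) ε b → TypicalB H A ε b
  typical-∁ {b} = subst₂ ℚ._≤_ (cong toQ (lABB-∁ H A b)) thrABB-∁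

2*[1+kC2]≡[1+k]*k : ∀ k → 2 * (suc k C 2) ≡ suc k * k
2*[1+kC2]≡[1+k]*k zero    = refl
2*[1+kC2]≡[1+k]*k (suc k) = begin
  2 * (suc (suc k) C 2)             ≡⟨ cong (2 *_) (nCk+nC[k+1]≡[n+1]C[k+1] (suc k) 1) ⟨
  2 * (suc k C 1 + suc k C 2)       ≡⟨ cong (λ t → 2 * (t + suc k C 2)) (nC1≡n (suc k)) ⟩
  2 * (suc k + suc k C 2)           ≡⟨ *-distribˡ-+ 2 (suc k) (suc k C 2) ⟩
  2 * suc k + 2 * (suc k C 2)       ≡⟨ cong (2 * suc k +_) (2*[1+kC2]≡[1+k]*k k) ⟩
  2 * suc k + suc k * k             ≡⟨ solve 1 (λ x → con 2 :* (con 1 :+ x) :+ (con 1 :+ x) :* x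
                                                   := (con 2 :+ x) :* (con 1 :+ x)) refl k ⟩
  suc (suc k) * suc k               ∎
  where open ≡-Reasoning

2*[n+n]^2*D≤n*[nC2] : ∀ {k D} → 16 * D ≤ k → 2 * (suc k + suc k) ^ 2 * D ≤ suc k * (suc k C 2)
2*[n+n]^2*D≤n*[nC2] {k} {D} 16D≤k = *-cancelˡ-≤ 2 (begin
  2 * (2 * (n + n) ^ 2 * D) ≡⟨ solve 2 (λ n d → con 2 :* (con 2 :* ((n :+ n) :^ 2) :* d) := (n :* n) :* (con 16 :* d)) refl n D ⟩
  n * n * (16 * D)          ≤⟨ *-monoʳ-≤ (n * n) 16D≤k ⟩
  n * n * k                 ≡⟨ *-assoc n n k ⟩
  n * (n * k)               ≡⟨ cong (n *_) (2*[1+kC2]≡[1+k]*k k) ⟨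
  n * (2 * (n C 2))         ≡⟨ solve 2 (λ a b → a :* (con 2 :* b) := con 2 :* (a :* b)) refl n (n C 2) ⟩
  2 * (n * (n C 2))         ∎)
  where
  open ≤-Reasoning
  n = suc k

-- With ε = P / D: d_a ≤ 2 d_b + c, d_b ≤ ε K and c ≤ K / D give d_a ≤ 3 ε K.
transfer-bound : ∀ {x y c D P K} → x ≤ 2 * y + c → y * D ≤ P * K → c * D ≤ K → 1 ≤ P → x * D ≤ 3 * P * K
transfer-bound {x} {y} {c} {D} {P} {K} x≤ y≤ c≤ 1≤P = begin
  x * D                 ≤⟨ *-monoˡ-≤ D x≤ ⟩
  (2 * y + c) * D       ≡⟨ solve 3 (λ y c d → (con 2 :* y :+ c) :* d := con 2 :* (y :* d) :+ c :* d) refl y c D ⟩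
  2 * (y * D) + c * D   ≤⟨ +-mono-≤ (*-monoʳ-≤ 2 y≤) c≤ ⟩
  2 * (P * K) + K       ≤⟨ +-monoʳ-≤ (2 * (P * K)) (≤-trans (≤-reflexive (sym (*-identityˡ K))) (*-monoˡ-≤ K 1≤P)) ⟩
  2 * (P * K) + P * K   ≡⟨ solve 2 (λ p k → con 2 :* (p :* k) :+ p :* k := con 3 :* p :* k) refl P K ⟩
  3 * P * K             ∎
  where open ≤-Reasoning

toℚᵘ-toQ : ∀ x → toℚᵘ (toQ x) ≃ᵘ mkℚᵘ (ℤ.+ x) 0
toℚᵘ-toQ x = toℚᵘ-fromℚᵘ (mkℚᵘ (ℤ.+ x) 0)

[a/1+d]*b≃ab/1+d : ∀ a b d → mkℚᵘ (ℤ.+ a) d *ᵘ mkℚᵘ (ℤ.+ b) 0 ≃ᵘ mkℚᵘ (ℤ.+ (a * b)) d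
[a/1+d]*b≃ab/1+d a b d = *≡* (cong₂ ℤ._*_ (ℤ.+◃n≡+n (a * b)) (cong (λ t → ℤ.+ suc t) (sym (*-identityʳ d))))

a*[b/1+d]≃ab/1+d : ∀ a b d → mkℚᵘ (ℤ.+ a) 0 *ᵘ mkℚᵘ (ℤ.+ b) d ≃ᵘ mkℚᵘ (ℤ.+ (a * b)) d
a*[b/1+d]≃ab/1+d a b d = *≡* (cong₂ ℤ._*_ (ℤ.+◃n≡+n (a * b)) (cong (λ t → ℤ.+ suc t) (sym (+-identityʳ d))))

x≤N/[1+d]⇔x*[1+d]≤N : ∀ x N d → mkℚᵘ (ℤ.+ x) 0 ≤ᵘ mkℚᵘ (ℤ.+ N) d ⇔ x * suc d ≤ N
x≤N/[1+d]⇔x*[1+d]≤N x N d = mk⇔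
  (λ { (*≤* le) → ℤ.drop‿+≤+ (subst₂ ℤ._≤_ (sym (ℤ.pos-* x (suc d))) (ℤ.*-identityʳ (ℤ.+ N)) le) })
  (λ le → *≤* (subst₂ ℤ._≤_ (ℤ.pos-* x (suc d)) (sym (ℤ.*-identityʳ (ℤ.+ N))) (ℤ.+≤+ le)))

toQ≤ε*toQ⇒*≤ : ∀ {x K P d} .{c : Coprime P (suc d)} → toQ x ℚ.≤ mkℚ (ℤ.+ P) d c ℚ.* toQ K → x * suc d ≤ P * K
toQ≤ε*toQ⇒*≤ {x} {K} {P} {d} {c} x≤εK = Equivalence.to (x≤N/[1+d]⇔x*[1+d]≤N x (P * K) d) (begin
  mkℚᵘ (ℤ.+ x) 0                       ≃⟨ toℚᵘ-toQ x ⟨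
  toℚᵘ (toQ x)                         ≤⟨ toℚᵘ-mono-≤ x≤εK ⟩
  toℚᵘ (mkℚ (ℤ.+ P) d c ℚ.* toQ K)     ≃⟨ toℚᵘ-homo-* (mkℚ (ℤ.+ P) d c) (toQ K) ⟩
  mkℚᵘ (ℤ.+ P) d *ᵘ toℚᵘ (toQ K)       ≃⟨ ℚᵘ.*-congˡ {mkℚᵘ (ℤ.+ P) d} (toℚᵘ-toQ K) ⟩
  mkℚᵘ (ℤ.+ P) d *ᵘ mkℚᵘ (ℤ.+ K) 0     ≃⟨ [a/1+d]*b≃ab/1+d P K d ⟩
  mkℚᵘ (ℤ.+ (P * K)) d                 ∎)
  where open ℚᵘ.≤-Reasoning

*≤⇒toQ≤3*ε*toQ : ∀ {x K P d} .{c : Coprime P (suc d)} →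
  x * suc d ≤ 3 * P * K → toQ x ℚ.≤ toQ 3 ℚ.* mkℚ (ℤ.+ P) d c ℚ.* toQ K
*≤⇒toQ≤3*ε*toQ {x} {K} {P} {d} {c} x*D≤3PK = toℚᵘ-cancel-≤ (begin
  toℚᵘ (toQ x)
    ≃⟨ toℚᵘ-toQ x ⟩
  mkℚᵘ (ℤ.+ x) 0
    ≤⟨ Equivalence.from (x≤N/[1+d]⇔x*[1+d]≤N x (3 * P * K) d) x*D≤3PK ⟩
  mkℚᵘ (ℤ.+ (3 * P * K)) d
    ≃⟨ [a/1+d]*b≃ab/1+d (3 * P) K d ⟨
  mkℚᵘ (ℤ.+ (3 * P)) d *ᵘ mkℚᵘ (ℤ.+ K) 0
    ≃⟨ ℚᵘ.*-congʳ {mkℚᵘ (ℤ.+ K) 0} (a*[b/1+d]≃ab/1+d 3 P d) ⟨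
  mkℚᵘ (ℤ.+ 3) 0 *ᵘ mkℚᵘ (ℤ.+ P) d *ᵘ mkℚᵘ (ℤ.+ K) 0
    ≃⟨ ℚᵘ.*-cong (ℚᵘ.*-congʳ {mkℚᵘ (ℤ.+ P) d} (toℚᵘ-toQ 3)) (toℚᵘ-toQ K) ⟨
  toℚᵘ (toQ 3) *ᵘ mkℚᵘ (ℤ.+ P) d *ᵘ toℚᵘ (toQ K)
    ≃⟨ ℚᵘ.*-congʳ {toℚᵘ (toQ K)} (toℚᵘ-homo-* (toQ 3) (mkℚ (ℤ.+ P) d c)) ⟨
  toℚᵘ (toQ 3 ℚ.* mkℚ (ℤ.+ P) d c) *ᵘ toℚᵘ (toQ K)
    ≃⟨ toℚᵘ-homo-* (toQ 3 ℚ.* mkℚ (ℤ.+ P) d c) (toQ K) ⟨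
  toℚᵘ (toQ 3 ℚ.* mkℚ (ℤ.+ P) d c ℚ.* toQ K) ∎)
  where open ℚᵘ.≤-Reasoning

module _ {P d} .{c : Coprime P (suc d)} {k} (16D≤k : 16 * suc d ≤ k) (1≤P : 1 ≤ P)
         {H : Hypergraph (suc k + suc k)} (uniform : Uniform4 H) (δ≥k : MinCodeg3≥ H k) where

  private
    ε : ℚ
    ε = mkℚ (ℤ.+ P) d c

  anarchist∈B⇒typical∈A : ∀ {A} → IsMinPartition H (suc k) A → ∀ {a b} → a ∈ A → b ∈ ∁ A →
    AnarchistB H A ε b → TypicalA H A (toQ 3 ℚ.* ε) a
  anarchist∈B⇒typical∈A {A} min@(∣A∣≡n , ∣B∣≡n , _) {a} {b} a∈A b∈B anarchist =
    *≤⇒toQ≤3*ε*toQ {x = lABB H A a} {K = K} {c = c} (subst (λ t → t * suc d ≤ 3 * P * K) (sym lABB-a≡) a-bound)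
    where
    K = ∣ A ∣ * (∣ ∁ A ∣ C 2)
    lABB-a≡ : lABB H A a ≡ degree H A a 2
    lABB-a≡ = trans (linkCount≡degree uniform A a 1) (cong (λ t → degree H A a (1 + 𝟙 t)) ([]=⇒lookup a∈A))
    lABB-b≡ : lABB H A b ≡ degree H A b 1
    lABB-b≡ = trans (linkCount≡degree uniform A b 1) (cong (λ t → degree H A b (1 + 𝟙 t)) (x∈∁p⇒lookup≡false b∈B))
    codegrees-small : (codegree₂ H a b + codegree₂ H b a) * suc d ≤ K
    codegrees-small = begin
      (codegree₂ H a b + codegree₂ H b a) * suc d
        ≤⟨ *-monoˡ-≤ (suc d) (+-mono-≤ (codegree₂≤m^2 uniform a≢b) (codegree₂≤m^2 uniform (≢-sym a≢b))) ⟩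
      (m ^ 2 + m ^ 2) * suc d                     ≡⟨ cong (λ t → (m ^ 2 + t) * suc d) (+-identityʳ (m ^ 2)) ⟨
      2 * m ^ 2 * suc d                           ≤⟨ 2*[n+n]^2*D≤n*[nC2] 16D≤k ⟩
      suc k * (suc k C 2)                         ≡⟨ cong₂ (λ x y → x * (y C 2)) ∣A∣≡n ∣B∣≡n ⟨
      K                                           ∎
      where
      open ≤-Reasoning
      m = suc k + suc k
      a≢b = x∈p∧y∈∁p⇒x≢y a∈A b∈B
    b-bound : degree H A b 1 * suc d ≤ P * K
    b-bound = subst (λ t → t * suc d ≤ P * K) lABB-b≡ (toQ≤ε*toQ⇒*≤ {x = lABB H A b} {K = K} {c = c} anarchist)
    a-bound : degree H A a 2 * suc d ≤ 3 * P * K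
    a-bound = transfer-bound {y = degree H A b 1} (degree-transfer uniform δ≥k min a∈A b∈B) b-bound codegrees-small 1≤P

claim2p3 : (ε : ℚ) → ℚ.0ℚ ℚ.< ε →
    ∃[ N ] ((n : ℕ) → N ≤ n →
      (H : Hypergraph (n + n)) → Uniform4 H → MinCodeg3≥ H (n ∸ 1) →
      (A : Subset (n + n)) → IsMinPartition H n A →
        ((∃[ b ] (b ∈ ∁ A × AnarchistB H A ε b)) →
            (a : Fin (n + n)) → a ∈ A → TypicalA H A (toQ 3 ℚ.* ε) a)
        × ((∃[ a ] (a ∈ A × AnarchistA H A ε a)) →
            (b : Fin (n + n)) → b ∈ ∁ A → TypicalB H A (toQ 3 ℚ.* ε) b))
claim2p3 (mkℚ (ℤ.+ 0) d c) (ℚ.*<* (ℤ.+<+ ()))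
claim2p3 (mkℚ ℤ.-[1+ _ ] d c) (ℚ.*<* ())
claim2p3 ε@(mkℚ (ℤ.+ suc P) d c) _ = suc (16 * suc d) , λ where
  zero ()
  (suc k) (s≤s 16D≤k) H uniform δ≥k A min →
      (λ (b , b∈B , anarchist) a a∈A →
        anarchist∈B⇒typical∈A 16D≤k (s≤s z≤n) uniform δ≥k min a∈A b∈B anarchist)
    , (λ (a , a∈A , anarchist) b b∈B → typical-∁ H A (toQ 3 ℚ.* ε) {b}
        (anarchist∈B⇒typical∈A 16D≤k (s≤s z≤n) uniform δ≥k (minPartition-∁ uniform min)
          b∈B (subst (a ∈_) (sym (∁-involutive A)) a∈A) (anarchist-∁ H A ε {a} anarchist)))
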